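{- For every $n\ge 2$, $$|BC^n| = C_n \quad\text{and}\quad |BD^n| = C_n,$$ where $C_n=\frac{1}{n+1}\binom{2n}{n}$ is the $n$-th Catalan number, $BC^n$ is the set of standard puzzles of shape $2\times n$ each of whose pieces reduces to one of the pieces $B$ or $C$, and $BD^n$ is the set of standard puzzles of shape $2\times n$ each of whose pieces reduces to one of the pieces $B$ or $D$. Here $B$ is the standard piece with top-left $3$, top-right $4$, bottom-left $1$, bottom-right $2$; $C$ is the standard piece with top-left $4$, top-right $2$, bottom-left $1$, bottom-right $3$; and $D$ is the standard piece with top-left $2$, top-right $4$, bottom-left $1$, bottom-right $3$.
   Context: A piece is a unit square with four labels on its corners; a standard piece has labels exactly $1,2,3,4$. The reduction of a piece with four distinct labels is the standard piece obtained by replacing the labels by $1,2,3,4$ preserving their relative order. A standard puzzle of shape $2\times n$ is a $2\times n$ array $\begin{bmatrix}a_1&\cdots&a_n\\ b_1&\cdots&b_n\end{bmatrix}$ whose $2n$ entries are exactly $1,\dots,2n$; for $1\le i\le n-1$ its $i$-th piece is the square with top-left label $a_i$, top-right $a_{i+1}$, bottom-left $b_i$, bottom-right $b_{i+1}$. -}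

module Defs where

open import Data.Nat using (ℕ; zero; suc; _+_; _*_; _/_; _<ᵇ_; _≡ᵇ_; _≤ᵇ_)
open import Data.Nat.Combinatorics using (_C_)
open import Data.Bool using (Bool; true; false; _∧_; _∨_; T)
open import Data.List.Base using (List; []; _∷_; _++_; length; upTo; map; filterᵇ)
import Data.List.Base as L
open import Data.Vec using (Vec; toList)
open import Data.Product using (Σ; _×_; _,_)
open import Data.Fin using (Fin)
open import Function.Bundles using (_↔_)
open import Relation.Nullary.Decidable using (does)

catalan : ℕ → ℕ
catalan n = ((2 * n) C n) / suc n

record Piece : Set where
  constructor piece
  field
    tl tr bl br : ℕ

pieceB pieceC pieceD : Piece
pieceB = piece 3 4 1 2
pieceC = piece 4 2 1 3
pieceD = piece 2 4 1 3

rank : ℕ → Piece → ℕ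
rank x (piece a b c d) =
  suc (length (filterᵇ (λ y → y <ᵇ x) (a ∷ b ∷ c ∷ d ∷ [])))

-- reduction of a piece (meaningful when the labels are distinct)
reduce : Piece → Piece
reduce p@(piece a b c d) = piece (rank a p) (rank b p) (rank c p) (rank d p)

distinctᵇ : Piece → Bool
distinctᵇ (piece a b c d) =
  not' (a ≡ᵇ b) ∧ not' (a ≡ᵇ c) ∧ not' (a ≡ᵇ d) ∧
  not' (b ≡ᵇ c) ∧ not' (b ≡ᵇ d) ∧ not' (c ≡ᵇ d)
  where
  not' : Bool → Bool
  not' true = false
  not' false = true

pieceEqᵇ : Piece → Piece → Bool
pieceEqᵇ (piece a b c d) (piece a' b' c' d') =
  (a ≡ᵇ a') ∧ (b ≡ᵇ b') ∧ (c ≡ᵇ c') ∧ (d ≡ᵇ d')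

reducesToᵇ : Piece → Piece → Bool
reducesToᵇ p q = distinctᵇ p ∧ pieceEqᵇ (reduce p) q

-- the pieces of a 2 x n array given by rows a (top) and b (bottom):
-- the i-th piece has labels a_i, a_{i+1}, b_i, b_{i+1}
pieces : List ℕ → List ℕ → List Piece
pieces (a₁ ∷ a₂ ∷ as) (b₁ ∷ b₂ ∷ bs) = piece a₁ a₂ b₁ b₂ ∷ pieces (a₂ ∷ as) (b₂ ∷ bs)
pieces _ _ = []

isStandardᵇ : ℕ → List ℕ → List ℕ → Bool
isStandardᵇ n as bs =
  L.all (λ k → length (filterᵇ (λ x → x ≡ᵇ suc k) (as ++ bs)) ≡ᵇ 1) (upTo (2 * n))
  ∧ L.all (λ x → (1 ≤ᵇ x) ∧ (x ≤ᵇ 2 * n)) (as ++ bs)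

StandardPuzzle : ℕ → Set
StandardPuzzle n =
  Σ (Vec ℕ n × Vec ℕ n) λ { (a , b) → T (isStandardᵇ n (toList a) (toList b)) }

PuzzleSet : Piece → Piece → ℕ → Set
PuzzleSet P Q n =
  Σ (Vec ℕ n × Vec ℕ n) λ { (a , b) →
      T (isStandardᵇ n (toList a) (toList b)) ×
      T (L.all (λ p → reducesToᵇ p P ∨ reducesToᵇ p Q) (pieces (toList a) (toList b))) }

BC BD : ℕ → Set
BC = PuzzleSet pieceB pieceC
BD = PuzzleSet pieceB pieceD

-- Read from right to left, the rows of a standard 2 × n puzzle become two lists
-- aₙ … a₁ and bₙ … b₁. All its pieces reduce to B or D exactly when both lists
-- decrease and aᵢ > bᵢ, and all of them reduce to B exactly when both decrease and
-- aᵢ > bᵢ₊₁. Such pairs of lists, with aᵢ > bᵢ₊ₛ, are built uniquely by handing the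
-- largest remaining label to one of the two lists, which gives the lattice-path
-- recursion of `ballot s p q`; the ballot formula and the absorption identity turn
-- ballot 0 n n into C(2n, n)/(n + 1). In a B/C puzzle only the last piece can be C.
-- If it is not, the label 2n is aₙ and removing it leaves an all-B pair of sizes
-- (n − 1, n); if it is, 2n is aₙ₋₁, and removing it and moving aₙ into the bottom row
-- leaves an all-B pair of sizes (n − 2, n + 1). These two counts add up to ballot 0 n n.

module Submission where

open import Defs
open import Data.Nat
open import Data.Nat.Properties
open import Data.Nat.Combinatorics using (_C_; nCk+nC[k+1]≡[n+1]C[k+1]; nCk≡nC[n∸k]; nCn≡1; nC1≡n; k>n⇒nCk≡0)
open import Data.Nat.DivMod using (m*n/n≡m)
open import Data.Nat.Tactic.RingSolver using (solve-∀)
open import Data.Bool using (Bool; true; false; if_then_else_; T; _∧_; _∨_)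
open import Data.Bool.Properties using (T-irrelevant)
open import Data.Unit using (⊤; tt)
open import Data.Empty using (⊥; ⊥-elim)
open import Data.Product using (Σ; _×_; _,_; proj₁; proj₂; uncurry)
open import Data.Product.Function.NonDependent.Propositional using (_×-↔_)
open import Data.Product.Function.Dependent.Propositional using (Σ-↔)
open import Data.Sum using (_⊎_; inj₁; inj₂; [_,_]′)
open import Data.Sum.Function.Propositional using (_⊎-↔_)
open import Data.List using (List; []; _∷_; length; drop; _++_; _∷ʳ_; filterᵇ; reverse; applyUpTo; upTo)
import Data.List.Base as L
import Data.List.Properties as List
open import Data.List.Relation.Unary.All as All using (All; []; _∷_)
open import Data.List.Relation.Unary.All.Properties using (∷ʳ⁺)
open import Data.List.Relation.Unary.Linked as Linked using (Linked; []; [-]; _∷_)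
open import Data.Vec using (Vec; []; _∷_; toList)
import Data.Vec as Vec
import Data.Vec.Properties as Vec
open import Data.Fin using (Fin)
open import Data.Fin.Properties using (+↔⊎; 1↔⊤)
open import Function using (_∘_; id)
open import Function.Bundles using (_↔_; mk↔ₛ′)
open import Function.Properties.Inverse using (↔-refl; ↔-trans; ↔-sym)
open import Function.Related.Propositional using (module EquationalReasoning; bijection)
open import Relation.Nullary using (¬_; Dec; yes; no)
open import Relation.Nullary.Decidable using (toSum)
open import Relation.Binary.Definitions using (tri<; tri≈; tri>)
open import Relation.Binary.PropositionalEquality

∧-elimˡ : ∀ a {b} → T (a ∧ b) → T a
∧-elimˡ true _ = tt

∧-elimʳ : ∀ a {b} → T (a ∧ b) → T b
∧-elimʳ true t = t

∧-intro : ∀ {a b} → T a → T b → T (a ∧ b)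
∧-intro {true} _ t = t

∨-introˡ : ∀ {a} b → T a → T (a ∨ b)
∨-introˡ {true} _ _ = tt

∨-introʳ : ∀ a {b} → T b → T (a ∨ b)
∨-introʳ true  _ = tt
∨-introʳ false t = t

∨-elim-false : ∀ a {b} → a ≡ false → T (a ∨ b) → T b
∨-elim-false false _ t = t

∨-elim : ∀ a {b} → T (a ∨ b) → T a ⊎ T b
∨-elim true  _ = inj₁ tt
∨-elim false t = inj₂ t

≡ᵇ-self : ∀ n → (n ≡ᵇ n) ≡ true
≡ᵇ-self zero    = refl
≡ᵇ-self (suc n) = ≡ᵇ-self n

≡ᵇ-refl : ∀ n → T (n ≡ᵇ n)
≡ᵇ-refl n = ≡⇒≡ᵇ n n refl

≡ᵇ-false : ∀ {m n} → m ≢ n → (m ≡ᵇ n) ≡ false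
≡ᵇ-false {m} {n} m≢n with m ≡ᵇ n in eq
... | true  = ⊥-elim (m≢n (≡ᵇ⇒≡ m n (subst T (sym eq) tt)))
... | false = refl

<ᵇ-true : ∀ {m n} → m < n → (m <ᵇ n) ≡ true
<ᵇ-true {zero}  {suc n} _         = refl
<ᵇ-true {suc m} {suc n} (s≤s m<n) = <ᵇ-true m<n

<ᵇ-false : ∀ {m n} → n ≤ m → (m <ᵇ n) ≡ false
<ᵇ-false {m}     {zero}  _         = refl
<ᵇ-false {suc m} {suc n} (s≤s n≤m) = <ᵇ-false n≤m

⟦_⟧ : Bool → ℕ
⟦ true  ⟧ = 1
⟦ false ⟧ = 0

Σ-T-≡ : ∀ {A : Set} {P : A → Bool} {a a′ : A} → a ≡ a′ → (t : T (P a)) (t′ : T (P a′)) →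
        _≡_ {A = Σ A (T ∘ P)} (a , t) (a′ , t′)
Σ-T-≡ refl t t′ = cong (_ ,_) (T-irrelevant t t′)

-- Ballot numbers

ballot : ℕ → ℕ → ℕ → ℕ
ballot s zero    q       = 1
ballot s (suc p) zero    = 0
ballot s (suc p) (suc q) = (if s + suc p ≤ᵇ suc q then ballot s p (suc q) else 0) + ballot s (suc p) q

if-≤ᵇ-true : ∀ {m n} (x : ℕ) → m ≤ n → (if suc m ≤ᵇ suc n then x else 0) ≡ x
if-≤ᵇ-true {m} {n} x m≤n with m <ᵇ suc n in eq
... | true  = refl
... | false = ⊥-elim (subst T eq (<⇒<ᵇ (s≤s m≤n)))

if-≤ᵇ-false : ∀ {m n} (x : ℕ) → n < m → (if suc m ≤ᵇ suc n then x else 0) ≡ 0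
if-≤ᵇ-false {m} {n} x n<m with m <ᵇ suc n in eq
... | true  = ⊥-elim (<⇒≱ n<m (s≤s⁻¹ (<ᵇ⇒< m (suc n) (subst T (sym eq) _))))
... | false = refl

ballot-shift : ∀ p q → ballot 1 p (suc q) ≡ ballot 0 p q
ballot-shift zero    q       = refl
ballot-shift (suc p) zero    = refl
ballot-shift (suc p) (suc q) = cong₂ _+_ first (ballot-shift (suc p) q)
  where
  first : (if 1 + suc p ≤ᵇ suc (suc q) then ballot 1 p (suc (suc q)) else 0)
        ≡ (if 0 + suc p ≤ᵇ suc q then ballot 0 p (suc q) else 0)
  first with p <ᵇ suc q
  ... | true  = ballot-shift p (suc q)
  ... | false = refl

ballot-empty : ∀ p q → q < p → ballot 0 p q ≡ 0
ballot-empty (suc p) zero    _         = refl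
ballot-empty (suc p) (suc q) (s≤s q<p) =
  cong₂ _+_ (if-≤ᵇ-false _ q<p) (ballot-empty (suc p) q (m<n⇒m<1+n q<p))

pascal : ∀ n k → suc n C suc k ≡ n C k + n C suc k
pascal n k = sym (nCk+nC[k+1]≡[n+1]C[k+1] n k)

C-symmetric : ∀ a b → (a + b) C a ≡ (a + b) C b
C-symmetric a b = begin
  (a + b) C a             ≡⟨ nCk≡nC[n∸k] (m≤m+n a b) ⟩
  (a + b) C ((a + b) ∸ a) ≡⟨ cong ((a + b) C_) (m+n∸m≡n a b) ⟩
  (a + b) C b             ∎
  where open ≡-Reasoning

C-absorption : ∀ m k → suc k * (suc m C suc k) ≡ suc m * (m C k)
C-absorption zero    zero    = refl
C-absorption zero    (suc k) = trans (cong (suc (suc k) *_) (k>n⇒nCk≡0 {1} {2 + k} (s≤s (s≤s z≤n)))) (*-zeroʳ (suc (suc k)))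
C-absorption (suc m) zero    = trans (+-identityʳ _) (trans (nC1≡n (suc (suc m))) (sym (*-identityʳ _)))
C-absorption (suc m) (suc k) = begin
  (2 + k) * ((2 + m) C (2 + k))     ≡⟨ cong ((2 + k) *_) (pascal (suc m) (suc k)) ⟩
  (2 + k) * (X + W)                 ≡⟨ *-distribˡ-+ (2 + k) X W ⟩
  X + (1 + k) * X + (2 + k) * W     ≡⟨ cong₂ (λ u v → X + u + v) (C-absorption m k) (C-absorption m (suc k)) ⟩
  X + (1 + m) * Y + (1 + m) * Z     ≡⟨ +-assoc X _ _ ⟩
  X + ((1 + m) * Y + (1 + m) * Z)   ≡⟨ cong (X +_) (*-distribˡ-+ (1 + m) Y Z) ⟨
  X + (1 + m) * (Y + Z)             ≡⟨ cong (λ u → X + (1 + m) * u) (pascal m k) ⟨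
  (2 + m) * X                       ∎
  where
  open ≡-Reasoning
  X = suc m C suc k
  W = suc m C suc (suc k)
  Y = m C k
  Z = m C suc k

ballot-formula : ∀ p q → p ≤ q → ballot 0 p q + (p + q) C suc q ≡ (p + q) C q
ballot-formula zero    q       _ = trans (cong suc (k>n⇒nCk≡0 (n<1+n q))) (sym (nCn≡1 q))
ballot-formula (suc p) (suc q) (s≤s p≤q) with m≤n⇒m<n∨m≡n p≤q
... | inj₁ p<q = begin
  guarded + B + suc P C suc (suc q)
    ≡⟨ cong₂ (λ u v → u + B + v) (if-≤ᵇ-true _ p≤q) (pascal P (suc q)) ⟩
  A + B + (X₁ + X₂)
    ≡⟨ rearrange A B X₁ X₂ ⟩
  (A + X₂) + (B + X₁)
    ≡⟨ cong₂ _+_ (ballot-formula p (suc q) (m≤n⇒m≤1+n p≤q)) shifted ⟩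
  X₁ + P C q
    ≡⟨ +-comm X₁ _ ⟩
  P C q + X₁
    ≡⟨ pascal P q ⟨
  suc P C suc q
    ∎
  where
  open ≡-Reasoning
  P = p + suc q
  guarded = if suc p ≤ᵇ suc q then ballot 0 p (suc q) else 0
  A = ballot 0 p (suc q)
  B = ballot 0 (suc p) q
  X₁ = P C suc q
  X₂ = P C suc (suc q)
  rearrange : ∀ a b c d → a + b + (c + d) ≡ (a + d) + (b + c)
  rearrange = solve-∀
  shifted : B + X₁ ≡ P C q
  shifted = subst (λ t → B + t C suc q ≡ t C q) (sym (+-suc p q)) (ballot-formula (suc p) q p<q)
... | inj₂ refl = begin
  guarded + ballot 0 (suc p) p + suc P C suc (suc p)
    ≡⟨ cong₂ (λ u v → u + v + suc P C suc (suc p)) (if-≤ᵇ-true {p} _ ≤-refl) (ballot-empty (suc p) p (n<1+n p)) ⟩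
  A + 0 + suc P C suc (suc p)
    ≡⟨ cong (A + 0 +_) (pascal P (suc p)) ⟩
  A + 0 + (X₁ + X₂)
    ≡⟨ rearrange A X₁ X₂ ⟩
  (A + X₂) + X₁
    ≡⟨ cong (_+ X₁) (ballot-formula p (suc p) (n≤1+n p)) ⟩
  X₁ + X₁
    ≡⟨ cong (_+ X₁) (C-symmetric p (suc p)) ⟨
  P C p + X₁
    ≡⟨ pascal P p ⟨
  suc P C suc p
    ∎
  where
  open ≡-Reasoning
  P = p + suc p
  guarded = if suc p ≤ᵇ suc p then ballot 0 p (suc p) else 0
  A = ballot 0 p (suc p)
  X₁ = P C suc p
  X₂ = P C suc (suc p)
  rearrange : ∀ a c d → a + 0 + (c + d) ≡ (a + d) + c
  rearrange = solve-∀

C-central-absorption : ∀ n → suc n * ((n + n) C suc n) ≡ n * ((n + n) C n)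
C-central-absorption zero    = refl
C-central-absorption (suc k) = begin
  (2 + k) * (suc M C (2 + k)) ≡⟨ C-absorption M (suc k) ⟩
  suc M * (M C suc k)         ≡⟨ cong (suc M *_) (C-symmetric k (suc k)) ⟨
  suc M * (M C k)             ≡⟨ C-absorption M k ⟨
  suc k * (suc M C suc k)     ∎
  where
  open ≡-Reasoning
  M = k + suc k

ballot-diagonal : ∀ n → suc n * ballot 0 n n ≡ (n + n) C n
ballot-diagonal n = +-cancelʳ-≡ (n * X) (suc n * f) X (begin
  suc n * f + n * X       ≡⟨ cong (suc n * f +_) (C-central-absorption n) ⟨
  suc n * f + suc n * U   ≡⟨ *-distribˡ-+ (suc n) f U ⟨
  suc n * (f + U)         ≡⟨ cong (suc n *_) (ballot-formula n n ≤-refl) ⟩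
  X + n * X               ∎)
  where
  open ≡-Reasoning
  f = ballot 0 n n
  X = (n + n) C n
  U = (n + n) C suc n

2*n≡n+n : ∀ n → 2 * n ≡ n + n
2*n≡n+n n = cong (n +_) (+-identityʳ n)

catalan≡ballot : ∀ n → catalan n ≡ ballot 0 n n
catalan≡ballot n = begin
  ((2 * n) C n) / suc n             ≡⟨ cong (λ m → (m C n) / suc n) (2*n≡n+n n) ⟩
  ((n + n) C n) / suc n             ≡⟨ cong (_/ suc n) (trans (*-comm _ (suc n)) (ballot-diagonal n)) ⟨
  (ballot 0 n n * suc n) / suc n    ≡⟨ m*n/n≡m (ballot 0 n n) (suc n) ⟩
  ballot 0 n n                      ∎
  where open ≡-Reasoning

ballot-diagonal-split : ∀ k → ballot 0 (2 + k) (2 + k) ≡ ballot 1 (1 + k) (2 + k) + ballot 1 k (3 + k)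
ballot-diagonal-split k = begin
  ballot 0 (2 + k) (2 + k)
    ≡⟨ cong₂ _+_ (if-≤ᵇ-true {suc k} _ ≤-refl) (ballot-empty (2 + k) (1 + k) ≤-refl) ⟩
  ballot 0 (1 + k) (2 + k) + 0
    ≡⟨ +-identityʳ _ ⟩
  ballot 0 (1 + k) (2 + k)
    ≡⟨ cong (_+ ballot 0 (1 + k) (1 + k)) (if-≤ᵇ-true {k} _ (n≤1+n k)) ⟩
  ballot 0 k (2 + k) + ballot 0 (1 + k) (1 + k)
    ≡⟨ +-comm (ballot 0 k (2 + k)) _ ⟩
  ballot 0 (1 + k) (1 + k) + ballot 0 k (2 + k)
    ≡⟨ cong₂ _+_ (ballot-shift (1 + k) (1 + k)) (ballot-shift k (2 + k)) ⟨
  ballot 1 (1 + k) (2 + k) + ballot 1 k (3 + k)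
    ∎
  where open ≡-Reasoning

-- Ballot pairs and their number

IsBallotᵇ : ℕ → ℕ → ℕ → List ℕ → List ℕ → Bool
IsBallotᵇ s zero    zero    []       []       = true
IsBallotᵇ s zero    (suc q) []       (y ∷ ys) = (y ≡ᵇ suc q) ∧ IsBallotᵇ s zero q [] ys
IsBallotᵇ s (suc p) (suc q) (x ∷ xs) (y ∷ ys) =
  ((x ≡ᵇ suc p + suc q) ∧ ((s + suc p ≤ᵇ suc q) ∧ IsBallotᵇ s p (suc q) xs (y ∷ ys)))
  ∨ ((y ≡ᵇ suc p + suc q) ∧ IsBallotᵇ s (suc p) q (x ∷ xs) ys)
IsBallotᵇ s _ _ _ _ = false

BallotPair : ℕ → ℕ → ℕ → Set
BallotPair s p q = Σ (Vec ℕ p × Vec ℕ q) λ (xs , ys) → T (IsBallotᵇ s p q (toList xs) (toList ys))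

ballot-head-≤ : ∀ s p q x xs ys → T (IsBallotᵇ s (suc p) q (x ∷ xs) ys) → x ≤ suc p + q
ballot-head-≤ s p (suc q) x xs (y ∷ ys) t with x ≡ᵇ suc p + suc q in eq
... | true  = ≤-reflexive (≡ᵇ⇒≡ x _ (subst T (sym eq) tt))
... | false = ≤-trans (ballot-head-≤ s p q x xs ys (∧-elimʳ (y ≡ᵇ suc p + suc q) t)) (+-monoʳ-≤ (suc p) (n≤1+n q))

Fin-guard : ∀ b n → (T b × Fin n) ↔ Fin (if b then n else 0)
Fin-guard true  n = mk↔ₛ′ proj₂ (tt ,_) (λ _ → refl) (λ _ → refl)
Fin-guard false n = mk↔ₛ′ (λ { (() , _) }) (λ ()) (λ ()) (λ { (() , _) })

BallotPair-0-0 : ∀ s → BallotPair s 0 0 ↔ Fin 1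
BallotPair-0-0 s =
  ↔-trans (mk↔ₛ′ (λ _ → tt) (λ _ → ([] , []) , tt) (λ _ → refl) (λ { (([] , []) , tt) → refl })) (↔-sym 1↔⊤)

BallotPair-suc-0 : ∀ s p → BallotPair s (suc p) 0 ↔ Fin 0
BallotPair-suc-0 s p = mk↔ₛ′ (λ { ((_ ∷ _ , []) , ()) }) (λ ()) (λ ()) (λ { ((_ ∷ _ , []) , ()) })

BallotPair-0-suc : ∀ s q → BallotPair s 0 (suc q) ↔ BallotPair s 0 q
BallotPair-0-suc s q = mk↔ₛ′ to from (λ { (([] , _) , _) → Σ-T-≡ refl _ _ }) from-to
  where
  to : BallotPair s 0 (suc q) → BallotPair s 0 q
  to (([] , y ∷ ys) , t) = ([] , ys) , ∧-elimʳ (y ≡ᵇ suc q) t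
  from : BallotPair s 0 q → BallotPair s 0 (suc q)
  from (([] , ys) , t) = ([] , suc q ∷ ys) , ∧-intro (≡ᵇ-refl q) t
  from-to : ∀ e → from (to e) ≡ e
  from-to (([] , y ∷ ys) , t) = Σ-T-≡ (cong (λ z → [] , z ∷ ys) (sym (≡ᵇ⇒≡ y (suc q) (∧-elimˡ (y ≡ᵇ suc q) t)))) _ _

BallotPair-suc-suc : ∀ s p q → BallotPair s (suc p) (suc q) ↔
                     ((T (s + suc p ≤ᵇ suc q) × BallotPair s p (suc q)) ⊎ BallotPair s (suc p) q)
BallotPair-suc-suc s p q = mk↔ₛ′ to from to-from from-to
  where
  M = suc p + suc q
  c = s + suc p ≤ᵇ suc q
  Split = (T c × BallotPair s p (suc q)) ⊎ BallotPair s (suc p) q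

  topᵇ : ℕ → Vec ℕ p → ℕ → Vec ℕ q → Bool
  topᵇ x xs y ys = (x ≡ᵇ M) ∧ (c ∧ IsBallotᵇ s p (suc q) (toList xs) (y ∷ toList ys))

  split : ∀ x xs y ys b → topᵇ x xs y ys ≡ b → T (IsBallotᵇ s (suc p) (suc q) (x ∷ toList xs) (y ∷ toList ys)) → Split
  split x xs y ys true  eq _ = inj₁ (∧-elimˡ c t , (xs , y ∷ ys) , ∧-elimʳ c t)
    where t = ∧-elimʳ (x ≡ᵇ M) (subst T (sym eq) tt)
  split x xs y ys false eq t = inj₂ ((x ∷ xs , ys) , ∧-elimʳ (y ≡ᵇ M) (∨-elim-false (topᵇ x xs y ys) eq t))

  to : BallotPair s (suc p) (suc q) → Split
  to ((x ∷ xs , y ∷ ys) , t) = split x xs y ys _ refl t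

  from : Split → BallotPair s (suc p) (suc q)
  from (inj₁ (tc , (xs , y ∷ ys) , t)) = (M ∷ xs , y ∷ ys) , ∨-introˡ _ (∧-intro (≡ᵇ-refl M) (∧-intro tc t))
  from (inj₂ ((x ∷ xs , ys) , t))      = (x ∷ xs , M ∷ ys) , ∨-introʳ (topᵇ x xs M ys) (∧-intro (≡ᵇ-refl M) t)

  top-label : ∀ x xs y ys → T (topᵇ x xs y ys) → x ≡ M
  top-label x _ _ _ t = ≡ᵇ⇒≡ x M (∧-elimˡ (x ≡ᵇ M) t)

  bottom-label : ∀ x xs y ys → T (IsBallotᵇ s (suc p) (suc q) (x ∷ toList xs) (y ∷ toList ys)) →
                 topᵇ x xs y ys ≡ false → y ≡ M
  bottom-label x xs y ys t eq = ≡ᵇ⇒≡ y M (∧-elimˡ (y ≡ᵇ M) (∨-elim-false (topᵇ x xs y ys) eq t))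

  to-from : ∀ e → to (from e) ≡ e
  to-from (inj₁ (tc , (xs , y ∷ ys) , t)) = go _ refl _
    where
    go : ∀ b eq t′ → split M xs y ys b eq t′ ≡ inj₁ (tc , (xs , y ∷ ys) , t)
    go true  _  _ = cong inj₁ (cong₂ _,_ (T-irrelevant _ _) (Σ-T-≡ refl _ _))
    go false eq _ = ⊥-elim (subst T eq (∧-intro (≡ᵇ-refl M) (∧-intro tc t)))
  to-from (inj₂ ((x ∷ xs , ys) , t)) = go _ refl _
    where
    go : ∀ b eq t′ → split x xs M ys b eq t′ ≡ inj₂ ((x ∷ xs , ys) , t)
    go true  eq _ = ⊥-elim (<-irrefl (top-label x xs M ys (subst T (sym eq) tt))
                      (s≤s (subst (x ≤_) (sym (+-suc p q)) (ballot-head-≤ s p q x (toList xs) (toList ys) t))))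
    go false _  _ = cong inj₂ (Σ-T-≡ refl _ _)

  from-to : ∀ e → from (to e) ≡ e
  from-to ((x ∷ xs , y ∷ ys) , t) = go _ refl
    where
    go : ∀ b eq → from (split x xs y ys b eq t) ≡ ((x ∷ xs , y ∷ ys) , t)
    go true  eq = Σ-T-≡ (cong (λ z → z ∷ xs , y ∷ ys) (sym (top-label x xs y ys (subst T (sym eq) tt)))) _ _
    go false eq = Σ-T-≡ (cong (λ z → x ∷ xs , z ∷ ys) (sym (bottom-label x xs y ys t eq))) _ _

BallotPair↔Fin : ∀ s p q → BallotPair s p q ↔ Fin (ballot s p q)
BallotPair↔Fin s zero    zero    = BallotPair-0-0 s
BallotPair↔Fin s zero    (suc q) = ↔-trans (BallotPair-0-suc s q) (BallotPair↔Fin s zero q)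
BallotPair↔Fin s (suc p) zero    = BallotPair-suc-0 s p
BallotPair↔Fin s (suc p) (suc q) =
  ↔-trans (BallotPair-suc-suc s p q)
    (↔-trans ((↔-trans (↔-refl ×-↔ BallotPair↔Fin s p (suc q)) (Fin-guard _ _)) ⊎-↔ BallotPair↔Fin s (suc p) q)
      (↔-sym +↔⊎))

count : ℕ → List ℕ → ℕ
count k []       = 0
count k (x ∷ xs) = ⟦ x ≡ᵇ k ⟧ + count k xs

count-head : ∀ x xs → count x (x ∷ xs) ≡ suc (count x xs)
count-head x xs rewrite ≡ᵇ-self x = refl

count-other : ∀ {x k} xs → x ≢ k → count k (x ∷ xs) ≡ count k xs
count-other {x} {k} xs x≢k rewrite ≡ᵇ-false x≢k = refl

count-++ : ∀ k xs ys → count k (xs ++ ys) ≡ count k xs + count k ys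
count-++ k []       ys = refl
count-++ k (x ∷ xs) ys = trans (cong (⟦ x ≡ᵇ k ⟧ +_) (count-++ k xs ys)) (sym (+-assoc ⟦ x ≡ᵇ k ⟧ _ _))

head-occurs : ∀ x xs → 1 ≤ count x (x ∷ xs)
head-occurs x xs rewrite count-head x xs = s≤s z≤n

tail-occurs : ∀ {k} x xs → 1 ≤ count k xs → 1 ≤ count k (x ∷ xs)
tail-occurs {k} x xs occ = ≤-trans occ (m≤n+m (count k xs) ⟦ x ≡ᵇ k ⟧)

inRange : ℕ → ℕ → ℕ
inRange m zero    = 0
inRange m (suc k) = ⟦ k <ᵇ m ⟧

inRange≤1 : ∀ m k → inRange m k ≤ 1
inRange≤1 m zero    = z≤n
inRange≤1 m (suc k) with k <ᵇ m
... | true  = ≤-refl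
... | false = z≤n

inRange-pos : ∀ m k → 1 ≤ inRange m k → 1 ≤ k × k ≤ m
inRange-pos m (suc k) pos with k <ᵇ m in eq
... | true  = s≤s z≤n , <ᵇ⇒< k m (subst T (sym eq) tt)
... | false = ⊥-elim (1+n≰n pos)

inRange-in : ∀ {m k} → k < m → inRange m (suc k) ≡ 1
inRange-in k<m rewrite <ᵇ-true k<m = refl

inRange-above : ∀ m → inRange m (suc m) ≡ 0
inRange-above m rewrite <ᵇ-false (≤-refl {m}) = refl

inRange-suc : ∀ m k → k ≢ suc m → inRange (suc m) k ≡ inRange m k
inRange-suc m zero    _ = refl
inRange-suc m (suc k) k≢m with <-cmp k m
... | tri< k<m _ _ rewrite <ᵇ-true k<m | <ᵇ-true (m<n⇒m<1+n k<m) = refl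
... | tri≈ _ refl _ = ⊥-elim (k≢m refl)
... | tri> _ _ m<k rewrite <ᵇ-false (<⇒≤ m<k) | <ᵇ-false m<k = refl

record Standard (m : ℕ) (xs ys : List ℕ) : Set where
  constructor standard
  field counts : ∀ k → count k xs + count k ys ≡ inRange m k

open Standard

Standard-rangeˡ : ∀ {m xs ys y} → Standard m xs ys → 1 ≤ count y xs → 1 ≤ y × y ≤ m
Standard-rangeˡ {m} {xs} {ys} {y} std occ = inRange-pos m y (subst (1 ≤_) (counts std y) (≤-trans occ (m≤m+n _ _)))

Standard-rangeʳ : ∀ {m xs ys y} → Standard m xs ys → 1 ≤ count y ys → 1 ≤ y × y ≤ m
Standard-rangeʳ {m} {xs} {ys} {y} std occ = inRange-pos m y (subst (1 ≤_) (counts std y) (≤-trans occ (m≤n+m _ _)))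

Standard-swap : ∀ {m xs ys} → Standard m xs ys → Standard m ys xs
Standard-swap {xs = xs} {ys} std = standard λ k → trans (+-comm (count k ys) (count k xs)) (counts std k)

Standard-addˡ : ∀ {m xs ys} → Standard m xs ys → Standard (suc m) (suc m ∷ xs) ys
Standard-addˡ {m} {xs} {ys} std = standard counts′
  where
  counts′ : ∀ k → count k (suc m ∷ xs) + count k ys ≡ inRange (suc m) k
  counts′ k with suc m ≟ k
  ... | yes refl = begin
    count (suc m) (suc m ∷ xs) + count (suc m) ys ≡⟨ cong (_+ count (suc m) ys) (count-head (suc m) xs) ⟩
    suc (count (suc m) xs + count (suc m) ys)     ≡⟨ cong suc (trans (counts std (suc m)) (inRange-above m)) ⟩
    1                                             ≡⟨ inRange-in (n<1+n m) ⟨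
    inRange (suc m) (suc m)                       ∎
    where open ≡-Reasoning
  ... | no m≢k = trans (cong (_+ count k ys) (count-other xs m≢k)) (trans (counts std k) (sym (inRange-suc m k (m≢k ∘ sym))))

Standard-addʳ : ∀ {m xs ys} → Standard m xs ys → Standard (suc m) xs (suc m ∷ ys)
Standard-addʳ std = Standard-swap (Standard-addˡ (Standard-swap std))

Standard-removeˡ : ∀ {m xs ys} → Standard (suc m) (suc m ∷ xs) ys → Standard m xs ys
Standard-removeˡ {m} {xs} {ys} std = standard counts′
  where
  counts′ : ∀ k → count k xs + count k ys ≡ inRange m k
  counts′ k with suc m ≟ k
  ... | yes refl = suc-injective (begin
    suc (count (suc m) xs + count (suc m) ys)     ≡⟨ cong (_+ count (suc m) ys) (count-head (suc m) xs) ⟨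
    count (suc m) (suc m ∷ xs) + count (suc m) ys ≡⟨ counts std (suc m) ⟩
    inRange (suc m) (suc m)                       ≡⟨ inRange-in (n<1+n m) ⟩
    1                                             ≡⟨ cong suc (inRange-above m) ⟨
    suc (inRange m (suc m))                       ∎)
    where open ≡-Reasoning
  ... | no m≢k = trans (cong (_+ count k ys) (sym (count-other xs m≢k))) (trans (counts std k) (inRange-suc m k (m≢k ∘ sym)))

Standard-removeʳ : ∀ {m xs ys} → Standard (suc m) xs (suc m ∷ ys) → Standard m xs ys
Standard-removeʳ std = Standard-swap (Standard-removeˡ (Standard-swap std))

record Disjoint (xs ys : List ℕ) : Set where
  constructor disjoint
  field apart : ∀ u → 1 ≤ count u xs → 1 ≤ count u ys → ⊥

open Disjoint

Disjoint-tail : ∀ {x xs y ys} → Disjoint (x ∷ xs) (y ∷ ys) → Disjoint xs ys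
Disjoint-tail {x} {xs} {y} {ys} disj = disjoint λ u inxs inys → apart disj u (tail-occurs x xs inxs) (tail-occurs y ys inys)

Standard-disjoint : ∀ {m xs ys} → Standard m xs ys → Disjoint xs ys
Standard-disjoint {m} std = disjoint λ k inxs inys →
  1+n≰n (≤-trans (+-mono-≤ inxs inys) (subst (_≤ 1) (sym (counts std k)) (inRange≤1 m k)))

Descending : List ℕ → Set
Descending = Linked _>_

Descending-∷ : ∀ {m xs} → (∀ z → 1 ≤ count z xs → z ≤ m) → Descending xs → Descending (suc m ∷ xs)
Descending-∷ {xs = []}     _     []   = [-]
Descending-∷ {xs = z ∷ xs} bound desc = s≤s (bound z (head-occurs z xs)) ∷ desc

Descending-absent : ∀ {k x xs} → Descending (x ∷ xs) → x < k → count k (x ∷ xs) ≡ 0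
Descending-absent {k} {x} {[]}     _            x<k rewrite ≡ᵇ-false (<⇒≢ x<k) = refl
Descending-absent {k} {x} {y ∷ xs} (y<x ∷ desc) x<k rewrite ≡ᵇ-false (<⇒≢ x<k) = Descending-absent desc (<-trans y<x x<k)

maximum-at-headʳ : ∀ {m y ys} → Standard (suc m) [] (y ∷ ys) → Descending (y ∷ ys) → y ≡ suc m
maximum-at-headʳ {m} {y} {ys} std desc with y ≟ suc m
... | yes y≡M = y≡M
... | no  y≢M = ⊥-elim (0≢1+n (begin
  0                              ≡⟨ Descending-absent desc y<M ⟨
  count (suc m) (y ∷ ys)         ≡⟨ counts std (suc m) ⟩
  inRange (suc m) (suc m)        ≡⟨ inRange-in (n<1+n m) ⟩
  1                              ∎))
  where
  open ≡-Reasoning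
  y<M = ≤∧≢⇒< (proj₂ (Standard-rangeʳ {xs = []} std (head-occurs y ys))) y≢M

maximum-at-head : ∀ {m x xs y ys} → Standard (suc m) (x ∷ xs) (y ∷ ys) → Descending (x ∷ xs) → Descending (y ∷ ys) →
                  x ≢ suc m → y ≡ suc m
maximum-at-head {m} {x} {xs} {y} {ys} std descˣ descʸ x≢M with y ≟ suc m
... | yes y≡M = y≡M
... | no  y≢M = ⊥-elim (0≢1+n (begin
  0                                                ≡⟨ cong₂ _+_ (Descending-absent descˣ x<M) (Descending-absent descʸ y<M) ⟨
  count (suc m) (x ∷ xs) + count (suc m) (y ∷ ys)  ≡⟨ counts std (suc m) ⟩
  inRange (suc m) (suc m)                          ≡⟨ inRange-in (n<1+n m) ⟩
  1                                                ∎))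
  where
  open ≡-Reasoning
  x<M = ≤∧≢⇒< (proj₂ (Standard-rangeˡ std (head-occurs x xs))) x≢M
  y<M = ≤∧≢⇒< (proj₂ (Standard-rangeʳ std (head-occurs y ys))) y≢M

Dominates : List ℕ → List ℕ → Set
Dominates []       _        = ⊤
Dominates (x ∷ xs) []       = ⊥
Dominates (x ∷ xs) (y ∷ ys) = y < x × Dominates xs ys

-- For xs = aₚ … a₁ and ys = b_q … b₁ this says aᵢ > bᵢ₊ₛ for all i ≤ p.
ShiftDominates : ℕ → List ℕ → List ℕ → Set
ShiftDominates s []         ys = ⊤
ShiftDominates s xs@(_ ∷ _) ys = Σ ℕ λ d → length ys ≡ d + (s + length xs) × Dominates xs (drop d ys)

drop-∷ : ∀ d ys → d < length ys → Σ ℕ λ z → drop d ys ≡ z ∷ drop (suc d) ys × 1 ≤ count z ys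
drop-∷ zero    (y ∷ ys) _         = y , refl , head-occurs y ys
drop-∷ (suc d) (y ∷ ys) (s≤s d<n) with drop-∷ d ys d<n
... | z , eq , occ = z , eq , tail-occurs y ys occ

Dominates-drop : ∀ {x xs} d ys → Dominates (x ∷ xs) (drop d ys) → Dominates xs (drop (suc d) ys)
Dominates-drop zero    (y ∷ ys) (_ , dom) = dom
Dominates-drop (suc d) (y ∷ ys) dom       = Dominates-drop d ys dom

ShiftDominates-bottom : ∀ {s xs ys} y → ShiftDominates s xs ys → ShiftDominates s xs (y ∷ ys)
ShiftDominates-bottom {xs = []}    y _               = tt
ShiftDominates-bottom {xs = _ ∷ _} y (d , len , dom) = suc d , cong suc len , dom

ShiftDominates-bottom⁻ : ∀ {s x xs y ys} → x < y → ShiftDominates s (x ∷ xs) (y ∷ ys) → ShiftDominates s (x ∷ xs) ys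
ShiftDominates-bottom⁻ x<y (zero  , _   , y<x , _) = ⊥-elim (<-asym x<y y<x)
ShiftDominates-bottom⁻ x<y (suc d , len , dom)     = d , suc-injective len , dom

ShiftDominates-top⁻ : ∀ {s x xs ys} → ShiftDominates s (x ∷ xs) ys → ShiftDominates s xs ys
ShiftDominates-top⁻ {s} {xs = []}      _               = tt
ShiftDominates-top⁻ {s} {xs = x′ ∷ xs} {ys} (d , len , dom) =
  suc d , trans len (trans (cong (d +_) (+-suc s _)) (+-suc d _)) , Dominates-drop d ys dom

Dominates-cons : ∀ {x xs} d ys → d < length ys → (∀ z → 1 ≤ count z ys → z < x) →
                 Dominates xs (drop (suc d) ys) → Dominates (x ∷ xs) (drop d ys)
Dominates-cons {x} {xs} d ys d<n below dom with drop-∷ d ys d<n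
... | z , eq , occ = subst (Dominates (x ∷ xs)) (sym eq) (below z occ , dom)

ShiftDominates-top : ∀ {s x xs ys} → s + suc (length xs) ≤ length ys → (∀ z → 1 ≤ count z ys → z < x) →
                     ShiftDominates s xs ys → ShiftDominates s (x ∷ xs) ys
ShiftDominates-top {s} {x} {[]} {ys} room below _ =
  d , len , Dominates-cons d ys (subst (d <_) (sym len) (m<m+n d (m≤n+m 1 s))) below tt
  where
  d = length ys ∸ (s + 1)
  len : length ys ≡ d + (s + 1)
  len = sym (m∸n+n≡m room)
ShiftDominates-top {s} {xs = _ ∷ _} room below (zero  , len , _) =
  ⊥-elim (<-irrefl refl (subst₂ _≤_ (+-suc s _) len room))
ShiftDominates-top {s} {x} {x′ ∷ xs} {ys} room below (suc d , len , dom) =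
  d , len′ , Dominates-cons d ys (subst (d <_) (sym len′) (m<m+n d (subst (0 <_) (sym (+-suc s _)) z<s))) below dom
  where
  len′ : length ys ≡ d + (s + suc (suc (length xs)))
  len′ = trans len (sym (trans (cong (d +_) (+-suc s _)) (+-suc d _)))

ShiftDominates-intro : ∀ {s xs ys} d → length ys ≡ d + (s + length xs) → Dominates xs (drop d ys) → ShiftDominates s xs ys
ShiftDominates-intro {xs = []}    d len dom = tt
ShiftDominates-intro {xs = _ ∷ _} d len dom = d , len , dom

ShiftDominates-elim : ∀ {s xs ys} d → length ys ≡ d + (s + length xs) → ShiftDominates s xs ys → Dominates xs (drop d ys)
ShiftDominates-elim {xs = []}             d len _ = tt
ShiftDominates-elim {s} {xs = x ∷ xs} {ys} d len (d′ , len′ , dom) =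
  subst (λ e → Dominates (x ∷ xs) (drop e ys)) (+-cancelʳ-≡ (s + suc (length xs)) d′ d (trans (sym len′) len)) dom

BallotLists : ℕ → ℕ → ℕ → List ℕ → List ℕ → Set
BallotLists s p q xs ys =
  length xs ≡ p × length ys ≡ q × Standard (p + q) xs ys × Descending xs × Descending ys × ShiftDominates s xs ys

IsBallotᵇ⇒BallotLists : ∀ s p q xs ys → T (IsBallotᵇ s p q xs ys) → BallotLists s p q xs ys
IsBallotᵇ⇒BallotLists s zero zero [] [] _ = refl , refl , standard (λ { zero → refl ; (suc k) → refl }) , [] , [] , tt
IsBallotᵇ⇒BallotLists s zero (suc q) [] (y ∷ ys) t
  with IsBallotᵇ⇒BallotLists s zero q [] ys (∧-elimʳ (y ≡ᵇ suc q) t) | ≡ᵇ⇒≡ y (suc q) (∧-elimˡ (y ≡ᵇ suc q) t)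
... | refl , refl , std , _ , descʸ , _ | refl =
  refl , refl , Standard-addʳ std , [] , Descending-∷ (λ _ occ → proj₂ (Standard-rangeʳ std occ)) descʸ , tt
IsBallotᵇ⇒BallotLists s (suc p) (suc q) (x ∷ xs) (y ∷ ys) t
  with ∨-elim ((x ≡ᵇ suc p + suc q) ∧ ((s + suc p ≤ᵇ suc q) ∧ IsBallotᵇ s p (suc q) xs (y ∷ ys))) t
... | inj₁ top
  with IsBallotᵇ⇒BallotLists s p (suc q) xs (y ∷ ys) (∧-elimʳ (s + suc p ≤ᵇ suc q) (∧-elimʳ (x ≡ᵇ suc p + suc q) top))
     | ≡ᵇ⇒≡ x _ (∧-elimˡ (x ≡ᵇ suc p + suc q) top)
     | ≤ᵇ⇒≤ (s + suc p) (suc q) (∧-elimˡ (s + suc p ≤ᵇ suc q) (∧-elimʳ (x ≡ᵇ suc p + suc q) top))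
... | refl , refl , std , descˣ , descʸ , sd | refl | room =
  refl , refl , Standard-addˡ std , Descending-∷ (λ _ occ → proj₂ (Standard-rangeˡ std occ)) descˣ , descʸ ,
  ShiftDominates-top room (λ _ occ → s≤s (proj₂ (Standard-rangeʳ std occ))) sd
IsBallotᵇ⇒BallotLists s (suc p) (suc q) (x ∷ xs) (y ∷ ys) t | inj₂ bottom
  with IsBallotᵇ⇒BallotLists s (suc p) q (x ∷ xs) ys (∧-elimʳ (y ≡ᵇ suc p + suc q) bottom)
     | ≡ᵇ⇒≡ y _ (∧-elimˡ (y ≡ᵇ suc p + suc q) bottom)
... | refl , refl , std , descˣ , descʸ , sd | refl =
  refl , refl , subst (λ m → Standard m (x ∷ xs) (m ∷ ys)) M≡ (Standard-addʳ std) , descˣ ,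
  subst (λ m → Descending (m ∷ ys)) M≡ (Descending-∷ (λ _ occ → proj₂ (Standard-rangeʳ std occ)) descʸ) ,
  ShiftDominates-bottom _ sd
  where M≡ = sym (+-suc (suc p) q)

IsBallotᵇ-intro : ∀ s xs ys → Standard (length xs + length ys) xs ys → Descending xs → Descending ys →
                  ShiftDominates s xs ys → T (IsBallotᵇ s (length xs) (length ys) xs ys)
IsBallotᵇ-intro s []       []       _   _     _     _ = tt
IsBallotᵇ-intro s (x ∷ xs) []       _   _     _     (d , len , _) =
  ⊥-elim (n≮0 (subst (length xs <_) (sym len) (≤-trans (m≤n+m _ s) (m≤n+m _ d))))
IsBallotᵇ-intro s []       (y ∷ ys) std _     descʸ _ =
  ∧-intro (≡⇒≡ᵇ y _ y≡M) (IsBallotᵇ-intro s [] ys (Standard-removeʳ std′) [] (Linked.tail descʸ) tt)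
  where
  y≡M = maximum-at-headʳ std descʸ
  std′ = subst (λ z → Standard _ [] (z ∷ ys)) y≡M std
-- Splitting with `with` here would hide from the termination checker that the
-- recursive calls descend lexicographically on (xs, ys).
IsBallotᵇ-intro s (x ∷ xs) (y ∷ ys) std descˣ descʸ sd = [
  (λ x≡M → ∨-introˡ _ (∧-intro (≡⇒≡ᵇ x M x≡M) (∧-intro (≤⇒≤ᵇ room)
    (IsBallotᵇ-intro s xs (y ∷ ys) (Standard-removeˡ (std-top x≡M)) (Linked.tail descˣ) descʸ (ShiftDominates-top⁻ sd))))) ,
  (λ x≢M → ∨-introʳ topᵇ (∧-intro (≡⇒≡ᵇ y M (y≡M x≢M))
    (IsBallotᵇ-intro s (x ∷ xs) ys (std-bottom x≢M) descˣ (Linked.tail descʸ) (ShiftDominates-bottom⁻ (x<y x≢M) sd)))) ]′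
  (toSum (x ≟ M))
  where
  M = suc (length xs) + suc (length ys)
  topᵇ = (x ≡ᵇ M) ∧ ((s + suc (length xs) ≤ᵇ suc (length ys)) ∧ IsBallotᵇ s (length xs) (suc (length ys)) xs (y ∷ ys))
  room : s + suc (length xs) ≤ suc (length ys)
  room = subst (s + suc (length xs) ≤_) (sym (proj₁ (proj₂ sd))) (m≤n+m _ (proj₁ sd))
  std-top : x ≡ M → Standard (suc (length xs + suc (length ys))) (M ∷ xs) (y ∷ ys)
  std-top x≡M = subst (λ z → Standard _ (z ∷ xs) (y ∷ ys)) x≡M std
  y≡M : x ≢ M → y ≡ M
  y≡M = maximum-at-head std descˣ descʸ
  x<y : x ≢ M → x < y
  x<y x≢M = subst (x <_) (sym (y≡M x≢M)) (≤∧≢⇒< (proj₂ (Standard-rangeˡ std (head-occurs x xs))) x≢M)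
  std-bottom : x ≢ M → Standard (suc (length xs) + length ys) (x ∷ xs) ys
  std-bottom x≢M = Standard-removeʳ (subst₂ (λ m z → Standard m (x ∷ xs) (z ∷ ys)) (+-suc (suc (length xs)) (length ys))
                                           (trans (y≡M x≢M) (+-suc (suc (length xs)) (length ys))) std)

BallotLists⇒IsBallotᵇ : ∀ {s p q xs ys} → BallotLists s p q xs ys → T (IsBallotᵇ s p q xs ys)
BallotLists⇒IsBallotᵇ {s} {xs = xs} {ys} (refl , refl , std , descˣ , descʸ , sd) = IsBallotᵇ-intro s xs ys std descˣ descʸ sd

length-filterᵇ-∷ : ∀ (P : ℕ → Bool) x xs → length (filterᵇ P (x ∷ xs)) ≡ ⟦ P x ⟧ + length (filterᵇ P xs)
length-filterᵇ-∷ P x xs with P x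
... | true  = refl
... | false = refl

⟦<ᵇ⟧-monoʳ : ∀ {x y} z → x ≤ y → ⟦ z <ᵇ x ⟧ ≤ ⟦ z <ᵇ y ⟧
⟦<ᵇ⟧-monoʳ {x} {y} z x≤y with z <ᵇ x in eq
... | false = z≤n
... | true rewrite <ᵇ-true (<-≤-trans (<ᵇ⇒< z x (subst T (sym eq) tt)) x≤y) = ≤-refl

count-below-mono : ∀ {x y} → x ≤ y → ∀ zs → length (filterᵇ (_<ᵇ x) zs) ≤ length (filterᵇ (_<ᵇ y) zs)
count-below-mono x≤y []       = z≤n
count-below-mono {x} {y} x≤y (z ∷ zs)
  rewrite length-filterᵇ-∷ (_<ᵇ x) z zs | length-filterᵇ-∷ (_<ᵇ y) z zs =
  +-mono-≤ (⟦<ᵇ⟧-monoʳ z x≤y) (count-below-mono x≤y zs)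

rank-mono : ∀ {x y} p → x ≤ y → rank x p ≤ rank y p
rank-mono (piece a b c d) x≤y = s≤s (count-below-mono x≤y (a ∷ b ∷ c ∷ d ∷ []))

rank-reflects-< : ∀ {u v i j} p → rank u p ≡ i → rank v p ≡ j → i < j → u < v
rank-reflects-< p ru rv i<j = ≰⇒> (λ v≤u → <⇒≱ (subst₂ _<_ (sym ru) (sym rv) i<j) (rank-mono p v≤u))

reduce-ranks : ∀ a b c d r₁ r₂ r₃ r₄ → T (reducesToᵇ (piece a b c d) (piece r₁ r₂ r₃ r₄)) →
               let p = piece a b c d in rank a p ≡ r₁ × rank b p ≡ r₂ × rank c p ≡ r₃ × rank d p ≡ r₄
reduce-ranks a b c d r₁ r₂ r₃ r₄ t =
  ≡ᵇ⇒≡ _ r₁ (∧-elimˡ (rank a p ≡ᵇ r₁) ranks) ,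
  ≡ᵇ⇒≡ _ r₂ (∧-elimˡ (rank b p ≡ᵇ r₂) (∧-elimʳ (rank a p ≡ᵇ r₁) ranks)) ,
  ≡ᵇ⇒≡ _ r₃ (∧-elimˡ (rank c p ≡ᵇ r₃) (∧-elimʳ (rank b p ≡ᵇ r₂) (∧-elimʳ (rank a p ≡ᵇ r₁) ranks))) ,
  ≡ᵇ⇒≡ _ r₄ (∧-elimʳ (rank c p ≡ᵇ r₃) (∧-elimʳ (rank b p ≡ᵇ r₂) (∧-elimʳ (rank a p ≡ᵇ r₁) ranks)))
  where
  p = piece a b c d
  ranks = ∧-elimʳ (distinctᵇ p) t

reducesToB⇒ : ∀ {a b c d} → T (reducesToᵇ (piece a b c d) pieceB) → c < d × d < a × a < b
reducesToB⇒ {a} {b} {c} {d} t with reduce-ranks a b c d 3 4 1 2 t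
... | ra , rb , rc , rd = rank-reflects-< p rc rd (n<1+n 1) , rank-reflects-< p rd ra (n<1+n 2) , rank-reflects-< p ra rb (n<1+n 3)
  where p = piece a b c d

reducesToC⇒ : ∀ {a b c d} → T (reducesToᵇ (piece a b c d) pieceC) → c < b × b < d × d < a
reducesToC⇒ {a} {b} {c} {d} t with reduce-ranks a b c d 4 2 1 3 t
... | ra , rb , rc , rd = rank-reflects-< p rc rb (n<1+n 1) , rank-reflects-< p rb rd (n<1+n 2) , rank-reflects-< p rd ra (n<1+n 3)
  where p = piece a b c d

reducesToD⇒ : ∀ {a b c d} → T (reducesToᵇ (piece a b c d) pieceD) → c < a × a < d × d < b
reducesToD⇒ {a} {b} {c} {d} t with reduce-ranks a b c d 2 4 1 3 t
... | ra , rb , rc , rd = rank-reflects-< p rc ra (n<1+n 1) , rank-reflects-< p ra rd (n<1+n 2) , rank-reflects-< p rd rb (n<1+n 3)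
  where p = piece a b c d

⟦<ᵇ⟧-below : ∀ {m n} → m < n → ⟦ m <ᵇ n ⟧ ≡ 1
⟦<ᵇ⟧-below m<n rewrite <ᵇ-true m<n = refl

⟦<ᵇ⟧-above : ∀ {m n} → n ≤ m → ⟦ m <ᵇ n ⟧ ≡ 0
⟦<ᵇ⟧-above n≤m rewrite <ᵇ-false n≤m = refl

rank-by-comparisons : ∀ {a b c d} x {i j k l} →
                      ⟦ a <ᵇ x ⟧ ≡ i → ⟦ b <ᵇ x ⟧ ≡ j → ⟦ c <ᵇ x ⟧ ≡ k → ⟦ d <ᵇ x ⟧ ≡ l →
                      rank x (piece a b c d) ≡ suc (i + (j + (k + (l + 0))))
rank-by-comparisons {a} {b} {c} {d} x refl refl refl refl =
  cong suc (trans (length-filterᵇ-∷ (_<ᵇ x) a _) (cong (⟦ a <ᵇ x ⟧ +_)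
    (trans (length-filterᵇ-∷ (_<ᵇ x) b _) (cong (⟦ b <ᵇ x ⟧ +_)
      (trans (length-filterᵇ-∷ (_<ᵇ x) c _) (cong (⟦ c <ᵇ x ⟧ +_) (length-filterᵇ-∷ (_<ᵇ x) d _)))))))

distinctᵇ-intro : ∀ {a b c d} → a ≢ b → a ≢ c → a ≢ d → b ≢ c → b ≢ d → c ≢ d → T (distinctᵇ (piece a b c d))
distinctᵇ-intro ab ac ad bc bd cd
  rewrite ≡ᵇ-false ab | ≡ᵇ-false ac | ≡ᵇ-false ad | ≡ᵇ-false bc | ≡ᵇ-false bd | ≡ᵇ-false cd = tt

reducesTo-intro : ∀ {a b c d r₁ r₂ r₃ r₄} → T (distinctᵇ (piece a b c d)) →
                  let p = piece a b c d in rank a p ≡ r₁ → rank b p ≡ r₂ → rank c p ≡ r₃ → rank d p ≡ r₄ →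
                  T (reducesToᵇ p (piece r₁ r₂ r₃ r₄))
reducesTo-intro {r₁ = r₁} {r₂} {r₃} {r₄} dist refl refl refl refl =
  ∧-intro dist (∧-intro (≡ᵇ-refl r₁) (∧-intro (≡ᵇ-refl r₂) (∧-intro (≡ᵇ-refl r₃) (≡ᵇ-refl r₄))))

module _ {w₁ w₂ w₃ w₄ : ℕ} (w₁<w₂ : w₁ < w₂) (w₂<w₃ : w₂ < w₃) (w₃<w₄ : w₃ < w₄) where
  private
    w₁<w₃ = <-trans w₁<w₂ w₂<w₃
    w₂<w₄ = <-trans w₂<w₃ w₃<w₄
    w₁<w₄ = <-trans w₁<w₃ w₃<w₄
    lo : ∀ {m n} → m < n → ⟦ m <ᵇ n ⟧ ≡ 1
    lo = ⟦<ᵇ⟧-below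
    hi : ∀ {m n} → n < m → ⟦ m <ᵇ n ⟧ ≡ 0
    hi n<m = ⟦<ᵇ⟧-above (<⇒≤ n<m)
    self : ∀ m → ⟦ m <ᵇ m ⟧ ≡ 0
    self m = ⟦<ᵇ⟧-above (≤-refl {m})
    ≢ : ∀ {m n} → m < n → n ≢ m
    ≢ m<n = <⇒≢ m<n ∘ sym

  reducesToB⇐ : T (reducesToᵇ (piece w₃ w₄ w₁ w₂) pieceB)
  reducesToB⇐ = reducesTo-intro {w₃} {w₄} {w₁} {w₂}
    (distinctᵇ-intro (<⇒≢ w₃<w₄) (≢ w₁<w₃) (≢ w₂<w₃) (≢ w₁<w₄) (≢ w₂<w₄) (<⇒≢ w₁<w₂))
    (rk w₃ (self w₃) (hi w₃<w₄) (lo w₁<w₃) (lo w₂<w₃))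
    (rk w₄ (lo w₃<w₄) (self w₄) (lo w₁<w₄) (lo w₂<w₄))
    (rk w₁ (hi w₁<w₃) (hi w₁<w₄) (self w₁) (hi w₁<w₂))
    (rk w₂ (hi w₂<w₃) (hi w₂<w₄) (lo w₁<w₂) (self w₂))
    where rk = rank-by-comparisons {w₃} {w₄} {w₁} {w₂}

  reducesToC⇐ : T (reducesToᵇ (piece w₄ w₂ w₁ w₃) pieceC)
  reducesToC⇐ = reducesTo-intro {w₄} {w₂} {w₁} {w₃}
    (distinctᵇ-intro (≢ w₂<w₄) (≢ w₁<w₄) (≢ w₃<w₄) (≢ w₁<w₂) (<⇒≢ w₂<w₃) (<⇒≢ w₁<w₃))
    (rk w₄ (self w₄) (lo w₂<w₄) (lo w₁<w₄) (lo w₃<w₄))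
    (rk w₂ (hi w₂<w₄) (self w₂) (lo w₁<w₂) (hi w₂<w₃))
    (rk w₁ (hi w₁<w₄) (hi w₁<w₂) (self w₁) (hi w₁<w₃))
    (rk w₃ (hi w₃<w₄) (lo w₂<w₃) (lo w₁<w₃) (self w₃))
    where rk = rank-by-comparisons {w₄} {w₂} {w₁} {w₃}

  reducesToD⇐ : T (reducesToᵇ (piece w₂ w₄ w₁ w₃) pieceD)
  reducesToD⇐ = reducesTo-intro {w₂} {w₄} {w₁} {w₃}
    (distinctᵇ-intro (<⇒≢ w₂<w₄) (≢ w₁<w₂) (<⇒≢ w₂<w₃) (≢ w₁<w₄) (≢ w₃<w₄) (<⇒≢ w₁<w₃))
    (rk w₂ (self w₂) (hi w₂<w₄) (lo w₁<w₂) (hi w₂<w₃))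
    (rk w₄ (lo w₂<w₄) (self w₄) (lo w₁<w₄) (lo w₃<w₄))
    (rk w₁ (hi w₁<w₂) (hi w₁<w₄) (self w₁) (hi w₁<w₃))
    (rk w₃ (lo w₂<w₃) (hi w₃<w₄) (lo w₁<w₃) (self w₃))
    where rk = rank-by-comparisons {w₂} {w₄} {w₁} {w₃}

T-all⁻ : ∀ {A : Set} (f : A → Bool) xs → T (L.all f xs) → All (T ∘ f) xs
T-all⁻ f []       _ = []
T-all⁻ f (x ∷ xs) t = ∧-elimˡ (f x) t ∷ T-all⁻ f xs (∧-elimʳ (f x) t)

T-all⁺ : ∀ {A : Set} (f : A → Bool) xs → All (T ∘ f) xs → T (L.all f xs)
T-all⁺ f []       _        = tt
T-all⁺ f (x ∷ xs) (t ∷ ts) = ∧-intro t (T-all⁺ f xs ts)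

T-all-occurs⁻ : ∀ (f : ℕ → Bool) xs → T (L.all f xs) → ∀ x → 1 ≤ count x xs → T (f x)
T-all-occurs⁻ f (y ∷ xs) t x occ with y ≡ᵇ x in eq
... | true  = subst (T ∘ f) (≡ᵇ⇒≡ y x (subst T (sym eq) tt)) (∧-elimˡ (f y) t)
... | false = T-all-occurs⁻ f xs (∧-elimʳ (f y) t) x occ

T-all-occurs⁺ : ∀ (f : ℕ → Bool) xs → (∀ x → 1 ≤ count x xs → T (f x)) → T (L.all f xs)
T-all-occurs⁺ f []       _ = tt
T-all-occurs⁺ f (y ∷ xs) h = ∧-intro (h y (head-occurs y xs)) (T-all-occurs⁺ f xs (λ x occ → h x (tail-occurs y xs occ)))

T-all-applyUpTo⁻ : ∀ (f : ℕ → Bool) g m → T (L.all f (applyUpTo g m)) → ∀ k → k < m → T (f (g k))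
T-all-applyUpTo⁻ f g (suc m) t zero    _         = ∧-elimˡ (f (g zero)) t
T-all-applyUpTo⁻ f g (suc m) t (suc k) (s≤s k<m) = T-all-applyUpTo⁻ f (g ∘ suc) m (∧-elimʳ (f (g zero)) t) k k<m

T-all-applyUpTo⁺ : ∀ (f : ℕ → Bool) g m → (∀ k → k < m → T (f (g k))) → T (L.all f (applyUpTo g m))
T-all-applyUpTo⁺ f g zero    _ = tt
T-all-applyUpTo⁺ f g (suc m) h = ∧-intro (h zero z<s) (T-all-applyUpTo⁺ f (g ∘ suc) m (λ k k<m → h (suc k) (s≤s k<m)))

length-filter-≡ᵇ : ∀ k xs → length (filterᵇ (_≡ᵇ k) xs) ≡ count k xs
length-filter-≡ᵇ k []       = refl
length-filter-≡ᵇ k (x ∷ xs) = trans (length-filterᵇ-∷ (_≡ᵇ k) x xs) (cong (⟦ x ≡ᵇ k ⟧ +_) (length-filter-≡ᵇ k xs))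

isStandardᵇ⇒Standard : ∀ n as bs → T (isStandardᵇ n as bs) → Standard (n + n) as bs
isStandardᵇ⇒Standard n as bs t =
  subst (λ m → Standard m as bs) (2*n≡n+n n) (standard λ k → trans (sym (count-++ k as bs)) (counts′ k))
  where
  m = 2 * n
  once = L.all (λ k → length (filterᵇ (λ x → x ≡ᵇ suc k) (as ++ bs)) ≡ᵇ 1) (upTo m)
  range : ∀ x → 1 ≤ count x (as ++ bs) → 1 ≤ x × x ≤ m
  range x occ = ≤ᵇ⇒≤ 1 x (∧-elimˡ (1 ≤ᵇ x) inside) , ≤ᵇ⇒≤ x m (∧-elimʳ (1 ≤ᵇ x) inside)
    where inside = T-all-occurs⁻ (λ x → (1 ≤ᵇ x) ∧ (x ≤ᵇ m)) (as ++ bs) (∧-elimʳ once t) x occ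
  absent : ∀ x → ¬ (1 ≤ x × x ≤ m) → count x (as ++ bs) ≡ 0
  absent x out with count x (as ++ bs) in eq
  ... | zero  = refl
  ... | suc _ = ⊥-elim (out (range x (subst (1 ≤_) (sym eq) (s≤s z≤n))))
  counts′ : ∀ k → count k (as ++ bs) ≡ inRange m k
  counts′ zero = absent zero (λ ())
  counts′ (suc k) with k <ᵇ m in eq
  ... | true  = trans (sym (length-filter-≡ᵇ (suc k) (as ++ bs)))
                      (≡ᵇ⇒≡ _ 1 (T-all-applyUpTo⁻ _ id m (∧-elimˡ once t) k (<ᵇ⇒< k m (subst T (sym eq) tt))))
  ... | false = absent (suc k) (λ (_ , k<m) → subst T eq (<⇒<ᵇ k<m))

Standard⇒isStandardᵇ : ∀ n as bs → Standard (n + n) as bs → T (isStandardᵇ n as bs)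
Standard⇒isStandardᵇ n as bs std = ∧-intro
  (T-all-applyUpTo⁺ _ id m λ k k<m →
    ≡⇒≡ᵇ _ 1 (trans (length-filter-≡ᵇ (suc k) (as ++ bs)) (trans (counts′ (suc k)) (inRange-in k<m))))
  (T-all-occurs⁺ _ (as ++ bs) λ x occ →
    let (1≤x , x≤m) = inRange-pos m x (subst (1 ≤_) (counts′ x) occ) in ∧-intro (≤⇒≤ᵇ 1≤x) (≤⇒≤ᵇ x≤m))
  where
  m = 2 * n
  counts′ : ∀ k → count k (as ++ bs) ≡ inRange m k
  counts′ k = trans (count-++ k as bs) (counts (subst (λ m → Standard m as bs) (sym (2*n≡n+n n)) std) k)

count-reverse : ∀ k xs → count k (reverse xs) ≡ count k xs
count-reverse k []       = refl
count-reverse k (x ∷ xs) = begin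
  count k (reverse (x ∷ xs))           ≡⟨ cong (count k) (List.unfold-reverse x xs) ⟩
  count k (reverse xs ++ x ∷ [])       ≡⟨ count-++ k (reverse xs) (x ∷ []) ⟩
  count k (reverse xs) + (⟦ x ≡ᵇ k ⟧ + 0) ≡⟨ cong₂ _+_ (count-reverse k xs) (+-identityʳ _) ⟩
  count k xs + ⟦ x ≡ᵇ k ⟧              ≡⟨ +-comm (count k xs) _ ⟩
  count k (x ∷ xs)                     ∎
  where open ≡-Reasoning

Standard-reverse : ∀ {m xs ys} → Standard m xs ys → Standard m (reverse xs) (reverse ys)
Standard-reverse {xs = xs} {ys} std = standard λ k → trans (cong₂ _+_ (count-reverse k xs) (count-reverse k ys)) (counts std k)

Standard-reverse⁻ : ∀ {m xs ys} → Standard m (reverse xs) (reverse ys) → Standard m xs ys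
Standard-reverse⁻ {m} {xs} {ys} std =
  subst₂ (Standard m) (List.reverse-involutive xs) (List.reverse-involutive ys) (Standard-reverse std)

reversedPieces : List ℕ → List ℕ → List Piece
reversedPieces (x ∷ y ∷ xs) (w ∷ z ∷ ys) = piece y x z w ∷ reversedPieces (y ∷ xs) (z ∷ ys)
reversedPieces _            _            = []

pieces-∷ʳ : ∀ as bs a x b y → length as ≡ length bs →
            pieces (as ++ a ∷ x ∷ []) (bs ++ b ∷ y ∷ []) ≡ pieces (as ∷ʳ a) (bs ∷ʳ b) ∷ʳ piece a x b y
pieces-∷ʳ []           []           a x b y _   = refl
pieces-∷ʳ (c ∷ [])     (d ∷ [])     a x b y _   = refl
pieces-∷ʳ (c ∷ e ∷ as) (d ∷ f ∷ bs) a x b y len =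
  cong (piece c e d f ∷_) (pieces-∷ʳ (e ∷ as) (f ∷ bs) a x b y (suc-injective len))

reverse-∷-∷ : ∀ (x y : ℕ) xs → reverse (x ∷ y ∷ xs) ≡ reverse xs ++ y ∷ x ∷ []
reverse-∷-∷ x y xs = trans (List.unfold-reverse x (y ∷ xs))
  (trans (cong (_∷ʳ x) (List.unfold-reverse y xs)) (List.++-assoc (reverse xs) (y ∷ []) (x ∷ [])))

pieces-reverse : ∀ xs ys → length xs ≡ length ys → pieces (reverse xs) (reverse ys) ≡ reverse (reversedPieces xs ys)
pieces-reverse []           []           _   = refl
pieces-reverse (x ∷ [])     (w ∷ [])     _   = refl
pieces-reverse (x ∷ y ∷ xs) (w ∷ z ∷ ys) len = begin
  pieces (reverse (x ∷ y ∷ xs)) (reverse (w ∷ z ∷ ys))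
    ≡⟨ cong₂ pieces (reverse-∷-∷ x y xs) (reverse-∷-∷ w z ys) ⟩
  pieces (reverse xs ++ y ∷ x ∷ []) (reverse ys ++ z ∷ w ∷ [])
    ≡⟨ pieces-∷ʳ (reverse xs) (reverse ys) y x z w (trans (List.length-reverse xs) (trans len′ (sym (List.length-reverse ys)))) ⟩
  pieces (reverse xs ∷ʳ y) (reverse ys ∷ʳ z) ∷ʳ piece y x z w
    ≡⟨ cong₂ (λ u v → pieces u v ∷ʳ piece y x z w) (List.unfold-reverse y xs) (List.unfold-reverse z ys) ⟨
  pieces (reverse (y ∷ xs)) (reverse (z ∷ ys)) ∷ʳ piece y x z w
    ≡⟨ cong (_∷ʳ piece y x z w) (pieces-reverse (y ∷ xs) (z ∷ ys) (suc-injective len)) ⟩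
  reverse (reversedPieces (y ∷ xs) (z ∷ ys)) ∷ʳ piece y x z w
    ≡⟨ List.unfold-reverse (piece y x z w) (reversedPieces (y ∷ xs) (z ∷ ys)) ⟨
  reverse (reversedPieces (x ∷ y ∷ xs) (w ∷ z ∷ ys))
    ∎
  where
  open ≡-Reasoning
  len′ = suc-injective (suc-injective len)

All-reverse : ∀ {A : Set} {P : A → Set} xs → All P xs → All P (reverse xs)
All-reverse []       []         = []
All-reverse (x ∷ xs) (px ∷ pxs) = subst (All _) (sym (List.unfold-reverse x xs)) (∷ʳ⁺ (All-reverse xs pxs) px)

All-reverse⁻ : ∀ {A : Set} {P : A → Set} xs → All P (reverse xs) → All P xs
All-reverse⁻ xs pxs = subst (All _) (List.reverse-involutive xs) (All-reverse (reverse xs) pxs)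

All-pieces-reverse⁻ : ∀ {P : Piece → Set} xs ys → length xs ≡ length ys →
                      All P (pieces (reverse xs) (reverse ys)) → All P (reversedPieces xs ys)
All-pieces-reverse⁻ xs ys len ps = All-reverse⁻ _ (subst (All _) (pieces-reverse xs ys len) ps)

All-pieces-reverse⁺ : ∀ {P : Piece → Set} xs ys → length xs ≡ length ys →
                      All P (reversedPieces xs ys) → All P (pieces (reverse xs) (reverse ys))
All-pieces-reverse⁺ xs ys len ps = subst (All _) (sym (pieces-reverse xs ys len)) (All-reverse _ ps)

reverse-rows : ∀ {n} → (Vec ℕ n × Vec ℕ n) ↔ (Vec ℕ n × Vec ℕ n)
reverse-rows = mk↔ₛ′ rev rev involutive involutive
  where
  rev = λ (a , b) → Vec.reverse a , Vec.reverse b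
  involutive = λ (a , b) → cong₂ _,_ (Vec.reverse-involutive a) (Vec.reverse-involutive b)

rows-reverse-↔ : ∀ {n} (P : List ℕ → List ℕ → Set) (Q : List ℕ → List ℕ → Bool) →
  (∀ {as bs} (p p′ : P as bs) → p ≡ p′) →
  (∀ {xs ys} → length xs ≡ n → length ys ≡ n → P (reverse xs) (reverse ys) → T (Q xs ys)) →
  (∀ {xs ys} → length xs ≡ n → length ys ≡ n → T (Q xs ys) → P (reverse xs) (reverse ys)) →
  Σ (Vec ℕ n × Vec ℕ n) (λ (a , b) → P (toList a) (toList b)) ↔
  Σ (Vec ℕ n × Vec ℕ n) (λ (xs , ys) → T (Q (toList xs) (toList ys)))
rows-reverse-↔ {n} P Q P-irrelevant P⇒Q Q⇒P = Σ-↔ reverse-rows (λ {rows} → fibre rows)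
  where
  reverse-toList : ∀ (a : Vec ℕ n) → reverse (toList (Vec.reverse a)) ≡ toList a
  reverse-toList a = trans (cong reverse (Vec.toList-reverse a)) (List.reverse-involutive (toList a))
  length-reversed : ∀ (a : Vec ℕ n) → length (toList (Vec.reverse a)) ≡ n
  length-reversed a = Vec.length-toList (Vec.reverse a)
  fibre : ∀ ((a , b) : Vec ℕ n × Vec ℕ n) →
          P (toList a) (toList b) ↔ T (Q (toList (Vec.reverse a)) (toList (Vec.reverse b)))
  fibre (a , b) = mk↔ₛ′
    (λ p → P⇒Q (length-reversed a) (length-reversed b) (subst₂ P (sym (reverse-toList a)) (sym (reverse-toList b)) p))
    (λ q → subst₂ P (reverse-toList a) (reverse-toList b) (Q⇒P (length-reversed a) (length-reversed b) q))
    (λ _ → T-irrelevant _ _) (λ _ → P-irrelevant _ _)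

Reversedᵇ : (Piece → Bool) → ℕ → List ℕ → List ℕ → Bool
Reversedᵇ f n xs ys = isStandardᵇ n (reverse xs) (reverse ys) ∧ L.all f (reversedPieces xs ys)

ReversedPuzzles : (Piece → Bool) → ℕ → Set
ReversedPuzzles f n = Σ (Vec ℕ n × Vec ℕ n) λ (xs , ys) → T (Reversedᵇ f n (toList xs) (toList ys))

Reversedᵇ⇒ : ∀ f n xs ys → T (Reversedᵇ f n xs ys) → Standard (n + n) xs ys × All (T ∘ f) (reversedPieces xs ys)
Reversedᵇ⇒ f n xs ys t =
  Standard-reverse⁻ (isStandardᵇ⇒Standard n (reverse xs) (reverse ys) (∧-elimˡ (isStandardᵇ n (reverse xs) (reverse ys)) t)) ,
  T-all⁻ f (reversedPieces xs ys) (∧-elimʳ (isStandardᵇ n (reverse xs) (reverse ys)) t)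

Reversedᵇ⇐ : ∀ f n xs ys → Standard (n + n) xs ys → All (T ∘ f) (reversedPieces xs ys) → T (Reversedᵇ f n xs ys)
Reversedᵇ⇐ f n xs ys std ps =
  ∧-intro (Standard⇒isStandardᵇ n (reverse xs) (reverse ys) (Standard-reverse std)) (T-all⁺ f (reversedPieces xs ys) ps)

PuzzleSet↔ReversedPuzzles : ∀ P Q n → PuzzleSet P Q n ↔ ReversedPuzzles (λ p → reducesToᵇ p P ∨ reducesToᵇ p Q) n
PuzzleSet↔ReversedPuzzles P Q n = rows-reverse-↔ rows (Reversedᵇ f n)
  (λ (s , a) (s′ , a′) → cong₂ _,_ (T-irrelevant s s′) (T-irrelevant a a′))
  (λ {xs} {ys} lenˣ lenʸ (ts , tp) → ∧-intro ts
    (T-all⁺ f _ (All-pieces-reverse⁻ xs ys (trans lenˣ (sym lenʸ)) (T-all⁻ f (pieces (reverse xs) (reverse ys)) tp))))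
  (λ {xs} {ys} lenˣ lenʸ t → ∧-elimˡ (isStandardᵇ n (reverse xs) (reverse ys)) t ,
    T-all⁺ f _ (All-pieces-reverse⁺ xs ys (trans lenˣ (sym lenʸ))
      (T-all⁻ f (reversedPieces xs ys) (∧-elimʳ (isStandardᵇ n (reverse xs) (reverse ys)) t))))
  where
  f = λ p → reducesToᵇ p P ∨ reducesToᵇ p Q
  rows = λ as bs → T (isStandardᵇ n as bs) × T (L.all f (pieces as bs))

Σ-T-↔ : ∀ {n} (P : List ℕ → List ℕ → Bool) (Q : List ℕ → List ℕ → Bool) →
  (∀ {xs ys} → length xs ≡ n → length ys ≡ n → T (P xs ys) → T (Q xs ys)) →
  (∀ {xs ys} → length xs ≡ n → length ys ≡ n → T (Q xs ys) → T (P xs ys)) →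
  Σ (Vec ℕ n × Vec ℕ n) (λ (xs , ys) → T (P (toList xs) (toList ys))) ↔
  Σ (Vec ℕ n × Vec ℕ n) (λ (xs , ys) → T (Q (toList xs) (toList ys)))
Σ-T-↔ P Q P⇒Q Q⇒P = Σ-↔ ↔-refl λ {(xs , ys)} →
  mk↔ₛ′ (P⇒Q (Vec.length-toList xs) (Vec.length-toList ys)) (Q⇒P (Vec.length-toList xs) (Vec.length-toList ys))
        (λ _ → T-irrelevant _ _) (λ _ → T-irrelevant _ _)

-- Puzzles with pieces B and D

BDᵇ : Piece → Bool
BDᵇ p = reducesToᵇ p pieceB ∨ reducesToᵇ p pieceD

BD-piece⇒ : ∀ {y x z w} → T (BDᵇ (piece y x z w)) → y < x × z < w × w < x × z < y
BD-piece⇒ {y} {x} {z} {w} t with ∨-elim (reducesToᵇ (piece y x z w) pieceB) t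
... | inj₁ b = let (z<w , w<y , y<x) = reducesToB⇒ b in y<x , z<w , <-trans w<y y<x , <-trans z<w w<y
... | inj₂ d = let (z<y , y<w , w<x) = reducesToD⇒ d in <-trans y<w w<x , <-trans z<y y<w , w<x , z<y

BD-piece⇐ : ∀ {y x z w} → y < x → z < w → w < x → z < y → y ≢ w → T (BDᵇ (piece y x z w))
BD-piece⇐ {y} {x} {z} {w} y<x z<w w<x z<y y≢w with <-cmp y w
... | tri< y<w _ _ = ∨-introʳ (reducesToᵇ (piece y x z w) pieceB) (reducesToD⇐ z<y y<w w<x)
... | tri≈ _ y≡w _ = ⊥-elim (y≢w y≡w)
... | tri> _ _ w<y = ∨-introˡ _ (reducesToB⇐ z<w w<y y<x)

-- Two columns are needed: a single column has no piece, so nothing would force a₁ > b₁.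
reversedPieces-BD⇒ : ∀ x y xs w z ys → length xs ≡ length ys → All (T ∘ BDᵇ) (reversedPieces (x ∷ y ∷ xs) (w ∷ z ∷ ys)) →
                     Descending (x ∷ y ∷ xs) × Descending (w ∷ z ∷ ys) × Dominates (x ∷ y ∷ xs) (w ∷ z ∷ ys)
reversedPieces-BD⇒ x y []        w z []        _   (t ∷ _) =
  let (y<x , z<w , w<x , z<y) = BD-piece⇒ t in (y<x ∷ [-]) , (z<w ∷ [-]) , (w<x , z<y , tt)
reversedPieces-BD⇒ x y (y′ ∷ xs) w z (z′ ∷ ys) len (t ∷ ts) =
  let (y<x , z<w , w<x , z<y) = BD-piece⇒ t
      (descˣ , descʸ , dom) = reversedPieces-BD⇒ y y′ xs z z′ ys (suc-injective len) ts
  in (y<x ∷ descˣ) , (z<w ∷ descʸ) , (w<x , dom)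

Disjoint-≢ : ∀ {x y xs w ys} → Disjoint (x ∷ y ∷ xs) (w ∷ ys) → y ≢ w
Disjoint-≢ {x} {y} {xs} {w} {ys} disj refl = apart disj y (tail-occurs x (y ∷ xs) (head-occurs y xs)) (head-occurs y ys)

reversedPieces-BD⇐ : ∀ x y xs w z ys → length xs ≡ length ys →
                     Descending (x ∷ y ∷ xs) → Descending (w ∷ z ∷ ys) → Dominates (x ∷ y ∷ xs) (w ∷ z ∷ ys) →
                     Disjoint (x ∷ y ∷ xs) (w ∷ z ∷ ys) → All (T ∘ BDᵇ) (reversedPieces (x ∷ y ∷ xs) (w ∷ z ∷ ys))
reversedPieces-BD⇐ x y []        w z []        _   (y<x ∷ _) (z<w ∷ _) (w<x , z<y , _) disj =
  BD-piece⇐ y<x z<w w<x z<y (Disjoint-≢ disj) ∷ []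
reversedPieces-BD⇐ x y (y′ ∷ xs) w z (z′ ∷ ys) len (y<x ∷ descˣ) (z<w ∷ descʸ) (w<x , z<y , dom) disj =
  BD-piece⇐ y<x z<w w<x z<y (Disjoint-≢ disj) ∷
  reversedPieces-BD⇐ y y′ xs z z′ ys (suc-injective len) descˣ descʸ (z<y , dom) (Disjoint-tail disj)

reversedBD⇒ballot : ∀ k {xs ys} → length xs ≡ 2 + k → length ys ≡ 2 + k →
                    T (Reversedᵇ BDᵇ (2 + k) xs ys) → T (IsBallotᵇ 0 (2 + k) (2 + k) xs ys)
reversedBD⇒ballot k {x ∷ y ∷ xs} {w ∷ z ∷ ys} lenˣ lenʸ t =
  let (std , ps) = Reversedᵇ⇒ BDᵇ (2 + k) (x ∷ y ∷ xs) (w ∷ z ∷ ys) t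
      (descˣ , descʸ , dom) = reversedPieces-BD⇒ x y xs w z ys (suc-injective (suc-injective (trans lenˣ (sym lenʸ)))) ps
  in BallotLists⇒IsBallotᵇ (lenˣ , lenʸ , std , descˣ , descʸ ,
                            ShiftDominates-intro {0} {x ∷ y ∷ xs} {w ∷ z ∷ ys} 0 (trans lenʸ (sym lenˣ)) dom)

ballot⇒reversedBD : ∀ k {xs ys} → length xs ≡ 2 + k → length ys ≡ 2 + k →
                    T (IsBallotᵇ 0 (2 + k) (2 + k) xs ys) → T (Reversedᵇ BDᵇ (2 + k) xs ys)
ballot⇒reversedBD k {x ∷ y ∷ xs} {w ∷ z ∷ ys} lenˣ lenʸ t =
  let (_ , _ , std , descˣ , descʸ , sd) = IsBallotᵇ⇒BallotLists 0 (2 + k) (2 + k) (x ∷ y ∷ xs) (w ∷ z ∷ ys) t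
  in Reversedᵇ⇐ BDᵇ (2 + k) (x ∷ y ∷ xs) (w ∷ z ∷ ys) std
       (reversedPieces-BD⇐ x y xs w z ys (suc-injective (suc-injective (trans lenˣ (sym lenʸ)))) descˣ descʸ
         (ShiftDominates-elim {0} {x ∷ y ∷ xs} {w ∷ z ∷ ys} 0 (trans lenʸ (sym lenˣ)) sd) (Standard-disjoint std))

catalan↔BD : ∀ k → Fin (catalan (2 + k)) ↔ BD (2 + k)
catalan↔BD k = subst (λ c → Fin c ↔ BD (2 + k)) (sym (catalan≡ballot (2 + k))) (↔-sym (begin
  BD (2 + k)                         ↔⟨ PuzzleSet↔ReversedPuzzles pieceB pieceD (2 + k) ⟩
  ReversedPuzzles BDᵇ (2 + k)        ↔⟨ Σ-T-↔ (Reversedᵇ BDᵇ (2 + k)) (IsBallotᵇ 0 (2 + k) (2 + k))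
                                            (λ {xs} {ys} → reversedBD⇒ballot k {xs} {ys})
                                            (λ {xs} {ys} → ballot⇒reversedBD k {xs} {ys}) ⟩
  BallotPair 0 (2 + k) (2 + k)       ↔⟨ BallotPair↔Fin 0 (2 + k) (2 + k) ⟩
  Fin (ballot 0 (2 + k) (2 + k))     ∎))
  where open EquationalReasoning {k = bijection}

-- Puzzles with pieces B and C

Bᵇ BCᵇ : Piece → Bool
Bᵇ p = reducesToᵇ p pieceB
BCᵇ p = reducesToᵇ p pieceB ∨ reducesToᵇ p pieceC

reversedPieces-B⇒ : ∀ x xs w ys → length xs ≡ length ys → All (T ∘ Bᵇ) (reversedPieces (x ∷ xs) (w ∷ ys)) →
                    Descending (x ∷ xs) × Descending (w ∷ ys) × Dominates xs (w ∷ ys)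
reversedPieces-B⇒ x []       w []       _   _        = [-] , [-] , tt
reversedPieces-B⇒ x (y ∷ xs) w (z ∷ ys) len (t ∷ ts) =
  let (z<w , w<y , y<x) = reducesToB⇒ t
      (descˣ , descʸ , dom) = reversedPieces-B⇒ y xs z ys (suc-injective len) ts
  in (y<x ∷ descˣ) , (z<w ∷ descʸ) , (w<y , dom)

reversedPieces-B⇐ : ∀ x xs w ys → length xs ≡ length ys →
                    Descending (x ∷ xs) → Descending (w ∷ ys) → Dominates xs (w ∷ ys) →
                    All (T ∘ Bᵇ) (reversedPieces (x ∷ xs) (w ∷ ys))
reversedPieces-B⇐ x []       w []       _   _              _              _           = []
reversedPieces-B⇐ x (y ∷ xs) w (z ∷ ys) len (y<x ∷ descˣ) (z<w ∷ descʸ) (w<y , dom) =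
  reducesToB⇐ z<w w<y y<x ∷ reversedPieces-B⇐ y xs z ys (suc-injective len) descˣ descʸ dom

B⇒BC : ∀ {ps} → All (T ∘ Bᵇ) ps → All (T ∘ BCᵇ) ps
B⇒BC = All.map (∨-introˡ _)

BC⇒B : ∀ y xs z ys → z < y → length xs ≡ length ys → All (T ∘ BCᵇ) (reversedPieces (y ∷ xs) (z ∷ ys)) →
       All (T ∘ Bᵇ) (reversedPieces (y ∷ xs) (z ∷ ys))
BC⇒B y []        z []        _   _   _        = []
BC⇒B y (y′ ∷ xs) z (z′ ∷ ys) z<y len (t ∷ ts) with ∨-elim (Bᵇ (piece y′ y z′ z)) t
... | inj₁ b = let (z′<z , z<y′ , _) = reducesToB⇒ b in b ∷ BC⇒B y′ xs z′ ys (<-trans z′<z z<y′) (suc-injective len) ts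
... | inj₂ c = let (_ , y<z , _) = reducesToC⇒ {y′} {y} {z′} {z} c in ⊥-elim (<-asym z<y y<z)

Standard-transfer : ∀ {m x y xs w ys} → Standard m (x ∷ y ∷ xs) (w ∷ ys) → Standard m (y ∷ xs) (w ∷ x ∷ ys)
Standard-transfer {x = x} {y} {xs} {w} {ys} std = standard λ k →
  trans (rearrange ⟦ x ≡ᵇ k ⟧ (count k (y ∷ xs)) ⟦ w ≡ᵇ k ⟧ (count k ys)) (counts std k)
  where
  rearrange : ∀ a b c d → b + (c + (a + d)) ≡ (a + b) + (c + d)
  rearrange = solve-∀

Standard-transfer⁻ : ∀ {m x y xs w ys} → Standard m (y ∷ xs) (w ∷ x ∷ ys) → Standard m (x ∷ y ∷ xs) (w ∷ ys)
Standard-transfer⁻ {x = x} {y} {xs} {w} {ys} std = standard λ k →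
  trans (rearrange ⟦ x ≡ᵇ k ⟧ (count k (y ∷ xs)) ⟦ w ≡ᵇ k ⟧ (count k ys)) (counts std k)
  where
  rearrange : ∀ a b c d → (a + b) + (c + d) ≡ b + (c + (a + d))
  rearrange = solve-∀

module _ (k : ℕ) where
  private
    m = suc k + suc (suc k)
    k+3+k≡m : k + (3 + k) ≡ m
    k+3+k≡m = +-suc k (2 + k)

  BC-top-maximum : ∀ {x y xs w z ys} → length xs ≡ k → length ys ≡ k →
                   Standard (suc m) (x ∷ y ∷ xs) (w ∷ z ∷ ys) →
                   All (T ∘ BCᵇ) (reversedPieces (x ∷ y ∷ xs) (w ∷ z ∷ ys)) →
                   x ≡ suc m → T (IsBallotᵇ 1 (1 + k) (2 + k) (y ∷ xs) (w ∷ z ∷ ys))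
  BC-top-maximum {x} {y} {xs} {w} {z} {ys} lenˣ lenʸ std (t ∷ ts) refl with ∨-elim (Bᵇ (piece y x z w)) t
  ... | inj₂ c = let (_ , x<w , _) = reducesToC⇒ {y} {x} {z} {w} c
                 in ⊥-elim (<⇒≱ x<w (proj₂ (Standard-rangeʳ std (head-occurs w (z ∷ ys)))))
  ... | inj₁ b =
    let (z<w , w<y , _) = reducesToB⇒ b
        len = trans lenˣ (sym lenʸ)
        (descʸ , descᶻ , dom) = reversedPieces-B⇒ y xs z ys len (BC⇒B y xs z ys (<-trans z<w w<y) len ts)
    in BallotLists⇒IsBallotᵇ (cong suc lenˣ , cong (2 +_) lenʸ , Standard-removeˡ std , descʸ , z<w ∷ descᶻ ,
         ShiftDominates-intro {1} {y ∷ xs} {w ∷ z ∷ ys} 0 (cong (2 +_) (sym len)) (w<y , dom))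

  BC-second-maximum : ∀ {x y xs w z ys} → length xs ≡ k → length ys ≡ k →
                      Standard (suc m) (x ∷ y ∷ xs) (w ∷ z ∷ ys) →
                      All (T ∘ BCᵇ) (reversedPieces (x ∷ y ∷ xs) (w ∷ z ∷ ys)) →
                      x ≢ suc m → y ≡ suc m × T (IsBallotᵇ 1 k (3 + k) xs (w ∷ x ∷ z ∷ ys))
  BC-second-maximum {x} {y} {xs} {w} {z} {ys} lenˣ lenʸ std (t ∷ ts) x≢M with ∨-elim (Bᵇ (piece y x z w)) t
  ... | inj₁ b =
    let (z<w , w<y , y<x) = reducesToB⇒ b
        (descʸ , descᶻ , _) = reversedPieces-B⇒ y xs z ys len (BC⇒B y xs z ys (<-trans z<w w<y) len ts)
        w≡M = maximum-at-head std (y<x ∷ descʸ) (z<w ∷ descᶻ) x≢M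
        x≤M = proj₂ (Standard-rangeˡ std (head-occurs x (y ∷ xs)))
    in ⊥-elim (<-irrefl w≡M (<-≤-trans (<-trans w<y y<x) x≤M))
    where len = trans lenˣ (sym lenʸ)
  ... | inj₂ c =
    let (z<x , x<w , w<y) = reducesToC⇒ {y} {x} {z} {w} c
        (descʸ , descᶻ , dom) = reversedPieces-B⇒ y xs z ys len (BC⇒B y xs z ys (<-trans z<x (<-trans x<w w<y)) len ts)
        descʷ = x<w ∷ z<x ∷ descᶻ
        y≡M = second-is-maximum (Standard-transfer std) descʸ descʷ w<y
        std′ = Standard-removeˡ (subst (λ v → Standard (suc m) (v ∷ xs) (w ∷ x ∷ z ∷ ys)) y≡M (Standard-transfer std))
    in y≡M , BallotLists⇒IsBallotᵇ (lenˣ , cong (3 +_) lenʸ ,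
               subst (λ n → Standard n xs (w ∷ x ∷ z ∷ ys)) (sym k+3+k≡m) std′ ,
               Linked.tail descʸ , descʷ ,
               ShiftDominates-intro {1} {xs} {w ∷ x ∷ z ∷ ys} 2 (cong (3 +_) (sym len)) dom)
    where
    len = trans lenˣ (sym lenʸ)
    second-is-maximum : Standard (suc m) (y ∷ xs) (w ∷ x ∷ z ∷ ys) → Descending (y ∷ xs) → Descending (w ∷ x ∷ z ∷ ys) →
                        w < y → y ≡ suc m
    second-is-maximum std″ descʸ descʷ w<y with y ≟ suc m
    ... | yes y≡M = y≡M
    ... | no  y≢M = ⊥-elim (<-irrefl (maximum-at-head std″ descʸ descʷ y≢M)
                      (<-≤-trans w<y (proj₂ (Standard-rangeˡ std″ (head-occurs y xs)))))

  BC-top-maximum⁻ : ∀ {y xs w z ys} → T (IsBallotᵇ 1 (1 + k) (2 + k) (y ∷ xs) (w ∷ z ∷ ys)) →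
                    Standard (suc m) (suc m ∷ y ∷ xs) (w ∷ z ∷ ys) ×
                    All (T ∘ BCᵇ) (reversedPieces (suc m ∷ y ∷ xs) (w ∷ z ∷ ys))
  BC-top-maximum⁻ {y} {xs} {w} {z} {ys} t =
    let (lenˣ , lenʸ , std , descʸ , descʷ , sd) = IsBallotᵇ⇒BallotLists 1 (1 + k) (2 + k) (y ∷ xs) (w ∷ z ∷ ys) t
        len = trans lenˣ (sym (suc-injective lenʸ))
    in Standard-addˡ std ,
       B⇒BC (reversedPieces-B⇐ (suc m) (y ∷ xs) w (z ∷ ys) len
               (Descending-∷ (λ _ occ → proj₂ (Standard-rangeˡ std occ)) descʸ) descʷ
               (ShiftDominates-elim {1} {y ∷ xs} {w ∷ z ∷ ys} 0 (trans lenʸ (sym (cong suc lenˣ))) sd))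

  BC-second-maximum⁻ : ∀ {xs w x z ys} → T (IsBallotᵇ 1 k (3 + k) xs (w ∷ x ∷ z ∷ ys)) →
                       Standard (suc m) (x ∷ suc m ∷ xs) (w ∷ z ∷ ys) ×
                       All (T ∘ BCᵇ) (reversedPieces (x ∷ suc m ∷ xs) (w ∷ z ∷ ys))
  BC-second-maximum⁻ {xs} {w} {x} {z} {ys} t with IsBallotᵇ⇒BallotLists 1 k (3 + k) xs (w ∷ x ∷ z ∷ ys) t
  ... | lenˣ , lenʸ , std , descˣ , x<w ∷ z<x ∷ descᶻ , sd =
    let std′ = subst (λ n → Standard n xs (w ∷ x ∷ z ∷ ys)) k+3+k≡m std
        w<M = s≤s (proj₂ (Standard-rangeʳ std′ (head-occurs w (x ∷ z ∷ ys))))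
    in Standard-transfer⁻ (Standard-addˡ std′) ,
       ∨-introʳ (Bᵇ (piece (suc m) x z w)) (reducesToC⇐ z<x x<w w<M) ∷
       B⇒BC (reversedPieces-B⇐ (suc m) xs z ys (trans lenˣ (sym (suc-injective (suc-injective (suc-injective lenʸ)))))
               (Descending-∷ (λ _ occ → proj₂ (Standard-rangeˡ std′ occ)) descˣ) descᶻ
               (ShiftDominates-elim {1} {xs} {w ∷ x ∷ z ∷ ys} 2 (trans lenʸ (sym (cong (3 +_) lenˣ))) sd))

  BC-second-not-maximum : ∀ {xs w x ys} → T (IsBallotᵇ 1 k (3 + k) xs (w ∷ x ∷ ys)) → x ≢ suc m
  BC-second-not-maximum {xs} {w} {x} {ys} t refl =
    let (_ , _ , std , _) = IsBallotᵇ⇒BallotLists 1 k (3 + k) xs (w ∷ x ∷ ys) t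
    in 1+n≰n (subst (x ≤_) k+3+k≡m (proj₂ (Standard-rangeʳ std (tail-occurs w (x ∷ ys) (head-occurs x ys)))))

ReversedBC↔BallotPairs : ∀ k → ReversedPuzzles BCᵇ (2 + k) ↔ (BallotPair 1 (1 + k) (2 + k) ⊎ BallotPair 1 k (3 + k))
ReversedBC↔BallotPairs k = mk↔ₛ′ to from to-from from-to
  where
  n = 2 + k
  M = n + n
  Split = BallotPair 1 (1 + k) (2 + k) ⊎ BallotPair 1 k (3 + k)

  classify : ∀ x y (xs : Vec ℕ k) w z (ys : Vec ℕ k) → Dec (x ≡ M) →
             T (Reversedᵇ BCᵇ n (x ∷ y ∷ toList xs) (w ∷ z ∷ toList ys)) → Split
  classify x y xs w z ys (yes x≡M) t =
    let (std , ps) = Reversedᵇ⇒ BCᵇ n (x ∷ y ∷ toList xs) (w ∷ z ∷ toList ys) t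
    in inj₁ ((y ∷ xs , w ∷ z ∷ ys) , BC-top-maximum k (Vec.length-toList xs) (Vec.length-toList ys) std ps x≡M)
  classify x y xs w z ys (no x≢M) t =
    let (std , ps) = Reversedᵇ⇒ BCᵇ n (x ∷ y ∷ toList xs) (w ∷ z ∷ toList ys) t
    in inj₂ ((xs , w ∷ x ∷ z ∷ ys) , proj₂ (BC-second-maximum k (Vec.length-toList xs) (Vec.length-toList ys) std ps x≢M))

  to : ReversedPuzzles BCᵇ n → Split
  to ((x ∷ y ∷ xs , w ∷ z ∷ ys) , t) = classify x y xs w z ys (x ≟ M) t

  from : Split → ReversedPuzzles BCᵇ n
  from (inj₁ ((y ∷ xs , w ∷ z ∷ ys) , t)) =
    (M ∷ y ∷ xs , w ∷ z ∷ ys) , uncurry (Reversedᵇ⇐ BCᵇ n _ _) (BC-top-maximum⁻ k {y} {toList xs} {w} {z} {toList ys} t)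
  from (inj₂ ((xs , w ∷ x ∷ z ∷ ys) , t)) =
    (x ∷ M ∷ xs , w ∷ z ∷ ys) , uncurry (Reversedᵇ⇐ BCᵇ n _ _) (BC-second-maximum⁻ k {toList xs} {w} {x} {z} {toList ys} t)

  to-from : ∀ e → to (from e) ≡ e
  to-from (inj₁ ((y ∷ xs , w ∷ z ∷ ys) , t)) with M ≟ M
  ... | yes _   = cong inj₁ (Σ-T-≡ refl _ _)
  ... | no  M≢M = ⊥-elim (M≢M refl)
  to-from (inj₂ ((xs , w ∷ x ∷ z ∷ ys) , t)) with x ≟ M
  ... | yes x≡M = ⊥-elim (BC-second-not-maximum k t x≡M)
  ... | no  _   = cong inj₂ (Σ-T-≡ refl _ _)

  from-to : ∀ e → from (to e) ≡ e
  from-to ((x ∷ y ∷ xs , w ∷ z ∷ ys) , t) with x ≟ M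
  ... | yes x≡M = Σ-T-≡ (cong (λ v → v ∷ y ∷ xs , w ∷ z ∷ ys) (sym x≡M)) _ _
  ... | no  x≢M =
    let (std , ps) = Reversedᵇ⇒ BCᵇ n (x ∷ y ∷ toList xs) (w ∷ z ∷ toList ys) t
        y≡M = proj₁ (BC-second-maximum k (Vec.length-toList xs) (Vec.length-toList ys) std ps x≢M)
    in Σ-T-≡ (cong (λ v → x ∷ v ∷ xs , w ∷ z ∷ ys) (sym y≡M)) _ _

catalan↔BC : ∀ k → Fin (catalan (2 + k)) ↔ BC (2 + k)
catalan↔BC k = subst (λ c → Fin c ↔ BC (2 + k)) (sym (trans (catalan≡ballot (2 + k)) (ballot-diagonal-split k))) (↔-sym (begin
  BC (2 + k)                                                    ↔⟨ PuzzleSet↔ReversedPuzzles pieceB pieceC (2 + k) ⟩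
  ReversedPuzzles BCᵇ (2 + k)                                   ↔⟨ ReversedBC↔BallotPairs k ⟩
  (BallotPair 1 (1 + k) (2 + k) ⊎ BallotPair 1 k (3 + k))       ↔⟨ BallotPair↔Fin 1 (1 + k) (2 + k) ⊎-↔ BallotPair↔Fin 1 k (3 + k) ⟩
  (Fin (ballot 1 (1 + k) (2 + k)) ⊎ Fin (ballot 1 k (3 + k)))   ↔⟨ +↔⊎ ⟨
  Fin (ballot 1 (1 + k) (2 + k) + ballot 1 k (3 + k))           ∎))
  where open EquationalReasoning {k = bijection}

theorem2 : ∀ (n : ℕ) → n ≥ 2 → (Fin (catalan n) ↔ BC n) × (Fin (catalan n) ↔ BD n)
theorem2 (suc (suc k)) (s≤s (s≤s z≤n)) = catalan↔BC k , catalan↔BD k
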